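{- Let $k$ be a non-negative integer and let $G$ be a graph of linear rank-width at most $k$ with $|V(G)|\geq 3$. Then there exists a graph $H$ having a pivot-minor isomorphic to $G$ such that the path-width of $H$ is at most $k+1$ and $|V(H)|\leq (2k+1)|V(G)|-6k$.
   Context: All graphs are finite, simple and undirected. For a graph $G$ and a vertex $v$, local complementation at $v$ produces the graph $G*v$ obtained from $G$ by replacing the edge set $E$ by $E\,\Delta\,\{xy: xv,yv\in E,\ x\neq y\}$. For an edge $uv$, pivoting $uv$ produces $G\wedge uv = G*u*v*u$. A graph $H'$ is a pivot-minor of $G$ if $H'$ can be obtained from $G$ by a sequence of vertex deletions and pivotings of edges. Let $A(G)$ denote the adjacency matrix of $G$ over the binary field; the cut-rank of $X\subseteq V(G)$ is the rank of the submatrix of $A(G)$ with rows $X$ and columns $V(G)\setminus X$. A tree is subcubic if it has at least two vertices and every vertex of degree other than $1$ has degree $3$. A caterpillar is a tree containing a path $P$ such that every vertex is at distance at most $1$ from $P$. A rank-decomposition of $G$ is a pair $(T,L)$ with $T$ a subcubic tree and $L$ a bijection from $V(G)$ to the leaves of $T$; the width of an edge $e$ of $T$ is the cut-rank of $L^{ -1}(X_e)$, where $X_e$ is the set of leaves in one component of $T\setminus e$; the width of $(T,L)$ is the maximum width of its edges. A linear rank-decomposition is a rank-decomposition $(T,L)$ with $T$ a caterpillar; the linear rank-width of $G$ is the minimum width of a linear rank-decomposition of $G$ (and is $0$ if $|V(G)|\le 1$). Path-width is the usual notion. -}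

module Defs where

open import Data.Nat using (ℕ; zero; suc; _≤_; _<_; _<ᵇ_)
open import Data.Bool using (Bool; true; false; not; _∧_; _xor_)
open import Data.Fin using (Fin; zero; suc; toℕ; punchIn; _≟_)
open import Data.Fin.Subset using (Subset; _∈_; _∉_; ∣_∣)
open import Data.Product using (Σ; ∃; _×_; _,_)
open import Data.Sum using (_⊎_)
open import Relation.Nullary.Decidable using (⌊_⌋)
open import Relation.Binary.PropositionalEquality using (_≡_)
open import Function.Bundles using (_↔_; Inverse)

-- Graphs on vertex set Fin n, given by adjacency (= the adjacency
-- matrix over GF(2), with Bool as the binary field: xor = +, ∧ = ·).

Adj : ℕ → Set
Adj n = Fin n → Fin n → Bool

IsSimple : ∀ {n} → Adj n → Set
IsSimple {n} G = (∀ (x y : Fin n) → G x y ≡ G y x) × (∀ (x : Fin n) → G x x ≡ false)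

localComp : ∀ {n} → Adj n → Fin n → Adj n
localComp G v x y = G x y xor (not ⌊ x ≟ y ⌋ ∧ (G x v ∧ G y v))

pivot : ∀ {n} → Adj n → Fin n → Fin n → Adj n
pivot G u v = localComp (localComp (localComp G u) v) u

deleteV : ∀ {n} → Adj (suc n) → Fin (suc n) → Adj n
deleteV G v x y = G (punchIn v x) (punchIn v y)

data PivotMinor : ∀ {m n} → Adj m → Adj n → Set where
  pm-refl  : ∀ {n} {G : Adj n} → PivotMinor G G
  pm-pivot : ∀ {m n} {H : Adj m} {G : Adj n} (u v : Fin n) →
             G u v ≡ true → PivotMinor H (pivot G u v) → PivotMinor H G
  pm-del   : ∀ {m n} {H : Adj m} {G : Adj (suc n)} (v : Fin (suc n)) →
             PivotMinor H (deleteV G v) → PivotMinor H G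

Isomorphic : ∀ {m n} → Adj m → Adj n → Set
Isomorphic {m} {n} G G' =
  Σ (Fin m ↔ Fin n) λ f → ∀ (x y : Fin m) → G x y ≡ G' (Inverse.to f x) (Inverse.to f y)

xorSum : ∀ {r} → (Fin r → Bool) → Bool
xorSum {zero}  f = false
xorSum {suc r} f = f zero xor xorSum (λ i → f (suc i))

-- cut-rank of X (given as a characteristic function) is at most k:
-- the rows of A(G)[X, V(G) \ X] span a GF(2)-space of dimension ≤ k,
-- i.e. they all lie in the span of some k vectors of GF(2)^(V \ X).
CutRank≤ : ∀ {n} → Adj n → (Fin n → Bool) → ℕ → Set
CutRank≤ {n} G X k =
  Σ (Fin k → Fin n → Bool) λ w →
    ∀ (x : Fin n) → X x ≡ true →
      Σ (Fin k → Bool) λ c →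
        ∀ (y : Fin n) → X y ≡ false →
          G x y ≡ xorSum (λ i → c i ∧ w i y)

singleton : ∀ {n} → Fin n → Fin n → Bool
singleton v x = ⌊ x ≟ v ⌋

-- A subcubic caterpillar T with n ≥ 2
-- leaves consists of a spine p₁ … p_{n-2} of degree-3 vertices with
-- two leaves at each end of the spine and one leaf at every inner
-- spine vertex (n = 2: T is a single edge).  A bijection L from V(G)
-- to the leaves is thus the same as an ordering σ of V(G), and the
-- edges of T induce exactly the following cuts: the singletons {v}
-- (leaf edges) and the prefixes {σ(0),…,σ(i-1)} (spine edges,
-- 2 ≤ i ≤ n-2).  Below we require all singletons and all prefixes
-- with 1 ≤ i ≤ n-1 to have cut-rank ≤ k (prefixes with i = 1 or
-- i = n-1 are singletons or complements of singletons, whose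
-- cut-ranks coincide with those of singletons).
prefix : ∀ {n} → (Fin n ↔ Fin n) → ℕ → Fin n → Bool
prefix σ i v = toℕ (Inverse.from σ v) <ᵇ i

LinearRankDecompOfWidth≤ : ∀ {n} → Adj n → ℕ → Set
LinearRankDecompOfWidth≤ {n} G k =
  Σ (Fin n ↔ Fin n) λ σ →
    (∀ (v : Fin n) → CutRank≤ G (singleton v) k) ×
    (∀ (i : ℕ) → 1 ≤ i → i < n → CutRank≤ G (prefix σ i) k)

-- linear rank-width ≤ k  (linear rank-width is 0 when |V(G)| ≤ 1)
LinearRankWidth≤ : ∀ {n} → Adj n → ℕ → Set
LinearRankWidth≤ {n} G k = (n ≤ 1) ⊎ LinearRankDecompOfWidth≤ G k

PathWidth≤ : ∀ {m} → Adj m → ℕ → Set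
PathWidth≤ {m} H w =
  Σ ℕ λ t → Σ (Fin t → Subset m) λ B →
    (∀ (v : Fin m) → ∃ λ i → v ∈ B i) ×
    (∀ (u v : Fin m) → H u v ≡ true → ∃ λ i → (u ∈ B i × v ∈ B i)) ×
    (∀ (v : Fin m) (i j l : Fin t) → toℕ i ≤ toℕ j → toℕ j ≤ toℕ l →
       v ∈ B i → v ∈ B l → v ∈ B j) ×
    (∀ (i : Fin t) → ∣ B i ∣ ≤ suc w)

module Submission where

-- Order V(G) by a linear rank-decomposition of width k and sweep the cut between the positions
-- ≤ c + 1 and ≥ c + 2 (stage c = 0, …, n - 4).  At each cut k rows of A(G) left of it span, over GF(2),
-- the adjacency of all left vertices to the right side; passing to the next cut, the entering row
-- is either spanned by them or replaces the last member of a linear relation among them, so the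
-- coefficients change by an upper triangular matrix.  H consists of the vertices of G, keeping
-- only the edges v₀v₁ and v_{n-2}v_{n-1}, and for each stage c and l < k a pair p_{c,l} q_{c,l}:
-- p_{c,l} sees the entering vertex through its coefficient, q_{c,l} sees the vertices next in line
-- through the l-th spanning row, p_{c,l} q_{c,l} is an edge and p_{c+1,j} q_{c,l} follow the transition
-- matrix.  Pivoting the pairs p_{c,l} q_{c,l} in order adds, edge by edge, the products
-- coefficient × spanning row across the cut, and deleting them leaves exactly G.  Giving stage c a
-- time window of length 2k and letting p_{c,l} live from slot l of stage c - 1 to slot l of stage c,
-- every vertex of H lives during an interval, and the intervals fall into k + 2 classes of pairwise
-- disjoint ones; hence the path-width is at most k + 1, and |V(H)| = n + 2k(n - 3).

open import Defs
open import Algebra.Bundles using (CommutativeRing)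
open import Data.Bool using (Bool; true; false; not; _∧_; _∨_; _xor_; if_then_else_)
open import Data.Bool.Properties
  using (xor-comm; xor-assoc; xor-identityʳ; xor-same; ∧-comm; ∧-assoc; ∧-zeroʳ; ∧-identityʳ;
         ∧-distribˡ-xor; ∧-distribʳ-xor; ∨-comm; ∨-identityʳ; ∨-zeroʳ; ¬-not; xor-∧-commutativeRing)
open import Algebra.Properties.CommutativeSemigroup
  (CommutativeRing.+-commutativeSemigroup xor-∧-commutativeRing) using (interchange)
open import Data.Empty using (⊥; ⊥-elim)
open import Data.Fin using (Fin; zero; suc; toℕ; fromℕ<; punchIn; punchOut; inject≤; _≟_)
open import Data.Fin.Properties
  using (any?; toℕ<n; toℕ-fromℕ<; fromℕ<-toℕ; toℕ-injective; punchOut-injective; suc-injective; inject≤-injective)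
open import Data.Fin.Subset using (Subset; inside; outside; _∈_; ∣_∣)
open import Data.Nat using (ℕ; zero; suc; pred; _+_; _*_; _≤_; _<_; z≤n; s≤s; _<ᵇ_; _≡ᵇ_; _<?_; _≤?_)
open import Data.Nat.Properties
  using (≤-refl; ≤-trans; <-trans; n≤1+n; m≤n⇒m≤1+n; <⇒≤; <-irrefl; <-cmp; <-≤-trans; ≤-<-trans; ≤-reflexive;
         m≤m+n; m≤n+m; +-suc; +-comm; +-assoc; +-identityʳ; <⇒≢; n<1+n; ≤-antisym; ≤-pred; +-mono-≤; +-monoˡ-≤;
         +-monoʳ-≤; *-monoˡ-≤; ≤∧≢⇒<; m<1+n⇒m<n∨m≡n)
open import Data.Nat.Tactic.RingSolver using (solve-∀)
open import Data.Product using (Σ; ∃; _×_; _,_; proj₁; proj₂)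
open import Data.Sum using (_⊎_; inj₁; inj₂)
open import Data.Unit using (⊤; tt)
open import Data.Vec using (_∷_; []; tabulate)
open import Data.Vec.Base using (here; there)
open import Data.Vec.Functional using (insertAt)
open import Data.Vec.Functional.Properties using (insertAt-lookup; insertAt-punchIn)
open import Data.Vec.Properties using (lookup∘tabulate; lookup⇒[]=; []=⇒lookup)
open import Function using (_on_; _∘_)
open import Function.Bundles using (_↔_; Inverse)
open import Function.Construct.Identity using (↔-id)
open import Function.Definitions using (Injective)
open import Relation.Binary using (tri<; tri≈; tri>)
open import Relation.Binary.PropositionalEquality
open import Relation.Nullary using (yes; no; contradiction)
open import Relation.Nullary.Decidable using (isYes≗does; dec-true; dec-false)

-- Linear algebra over GF(2)

xorSum-cong : ∀ {r} {f g : Fin r → Bool} → (∀ i → f i ≡ g i) → xorSum f ≡ xorSum g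
xorSum-cong {zero}  f≗g = refl
xorSum-cong {suc r} f≗g = cong₂ _xor_ (f≗g zero) (xorSum-cong (λ i → f≗g (suc i)))

xorSum-false : ∀ {r} {f : Fin r → Bool} → (∀ i → f i ≡ false) → xorSum f ≡ false
xorSum-false {zero}  f≗0 = refl
xorSum-false {suc r} f≗0 rewrite f≗0 zero = xorSum-false (λ i → f≗0 (suc i))

xorSum-xor : ∀ {r} (f g : Fin r → Bool) → xorSum (λ i → f i xor g i) ≡ xorSum f xor xorSum g
xorSum-xor {zero}  f g = refl
xorSum-xor {suc r} f g =
  trans (cong ((f zero xor g zero) xor_) (xorSum-xor (λ i → f (suc i)) (λ i → g (suc i))))
        (interchange (f zero) (g zero) _ _)

xorSum-∧ˡ : ∀ {r} b (f : Fin r → Bool) → xorSum (λ i → b ∧ f i) ≡ b ∧ xorSum f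
xorSum-∧ˡ {zero}  b f = sym (∧-zeroʳ b)
xorSum-∧ˡ {suc r} b f =
  trans (cong ((b ∧ f zero) xor_) (xorSum-∧ˡ b (λ i → f (suc i)))) (sym (∧-distribˡ-xor b _ _))

xorSum-∧ʳ : ∀ {r} b (f : Fin r → Bool) → xorSum (λ i → f i ∧ b) ≡ xorSum f ∧ b
xorSum-∧ʳ b f = trans (xorSum-cong (λ i → ∧-comm (f i) b)) (trans (xorSum-∧ˡ b f) (∧-comm b _))

xorSum-swap : ∀ {r s} (f : Fin r → Fin s → Bool) →
  xorSum (λ i → xorSum (f i)) ≡ xorSum (λ j → xorSum (λ i → f i j))
xorSum-swap {zero} {s}  f = sym (xorSum-false {s} (λ _ → refl))
xorSum-swap {suc r} {s} f =
  trans (cong (xorSum (f zero) xor_) (xorSum-swap (λ i → f (suc i))))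
        (sym (xorSum-xor (f zero) (λ j → xorSum (λ i → f (suc i) j))))

xorSum-punchIn : ∀ {r} (f : Fin (suc r) → Bool) i → xorSum f ≡ f i xor xorSum (λ j → f (punchIn i j))
xorSum-punchIn          f zero    = refl
xorSum-punchIn {suc r} f (suc i) = begin
  f zero xor xorSum (λ j → f (suc j))
    ≡⟨ cong (f zero xor_) (xorSum-punchIn (λ j → f (suc j)) i) ⟩
  f zero xor (f (suc i) xor rest)
    ≡⟨ sym (xor-assoc (f zero) _ _) ⟩
  (f zero xor f (suc i)) xor rest
    ≡⟨ cong (_xor rest) (xor-comm (f zero) (f (suc i))) ⟩
  (f (suc i) xor f zero) xor rest
    ≡⟨ xor-assoc (f (suc i)) _ _ ⟩
  f (suc i) xor (f zero xor rest) ∎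
  where
  open ≡-Reasoning
  rest = xorSum (λ j → f (suc (punchIn i j)))

δ : ∀ {r} → Fin r → Fin r → Bool
δ i j = toℕ i ≡ᵇ toℕ j

δ-refl : ∀ {r} (i : Fin r) → δ i i ≡ true
δ-refl zero    = refl
δ-refl (suc i) = δ-refl i

δ-sound : ∀ {r} (i j : Fin r) → δ i j ≡ true → i ≡ j
δ-sound zero    zero    _ = refl
δ-sound (suc i) (suc j) e = cong suc (δ-sound i j e)

xorSum-δˡ : ∀ {r} (d : Fin r) (f : Fin r → Bool) → xorSum (λ i → δ d i ∧ f i) ≡ f d
xorSum-δˡ {suc r} zero    f = trans (cong (f zero xor_) (xorSum-false {r} (λ _ → refl))) (xor-identityʳ (f zero))
xorSum-δˡ {suc r} (suc d) f = xorSum-δˡ d (λ i → f (suc i))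

xorSum-δʳ : ∀ {r} (d : Fin r) (f : Fin r → Bool) → xorSum (λ i → δ i d ∧ f i) ≡ f d
xorSum-δʳ {suc r} zero    f = trans (cong (f zero xor_) (xorSum-false {r} (λ _ → refl))) (xor-identityʳ (f zero))
xorSum-δʳ {suc r} (suc d) f = xorSum-δʳ d (λ i → f (suc i))

NontrivialRelation : ∀ {m k} → (Fin m → Fin k → Bool) → Set
NontrivialRelation {m} v =
  Σ (Fin m → Bool) λ s → (∃ λ i → s i ≡ true) × (∀ c → xorSum (λ i → s i ∧ v i c) ≡ false)

-- Gaussian elimination on the first coordinate.
linearlyDependent : ∀ {k m} → k < m → (v : Fin m → Fin k → Bool) → NontrivialRelation v
linearlyDependent {zero} {suc m} _ v = (λ _ → true) , (zero , refl) , λ ()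
linearlyDependent {suc k} {m} k<m v with any? (λ i → v i zero Data.Bool.≟ true)
... | no  none = s , nontrivial , vanishes
  where
  relation = linearlyDependent (≤-trans (n≤1+n (suc k)) k<m) (λ i c → v i (suc c))
  s = proj₁ relation
  nontrivial = proj₁ (proj₂ relation)
  vanishes : ∀ c → xorSum (λ i → s i ∧ v i c) ≡ false
  vanishes zero    = xorSum-false (λ i → trans (cong (s i ∧_) (¬-not (λ e → none (i , e)))) (∧-zeroʳ (s i)))
  vanishes (suc c) = proj₂ (proj₂ relation) c
linearlyDependent {suc k} {suc m} (s≤s k<m) v | yes (p , vp₀) = s , (punchIn p i₀ , s-i₀) , vanishes
  where
  u : Fin m → Fin k → Bool
  u j c = v (punchIn p j) (suc c) xor (v (punchIn p j) zero ∧ v p (suc c))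
  relation = linearlyDependent k<m u
  s′ = proj₁ relation
  i₀ = proj₁ (proj₁ (proj₂ relation))
  σ = xorSum (λ j → s′ j ∧ v (punchIn p j) zero)
  s = insertAt s′ p σ
  s-i₀ : s (punchIn p i₀) ≡ true
  s-i₀ = trans (insertAt-punchIn s′ p σ i₀) (proj₂ (proj₁ (proj₂ relation)))
  split : ∀ c → xorSum (λ x → s x ∧ v x c) ≡ (σ ∧ v p c) xor xorSum (λ j → s′ j ∧ v (punchIn p j) c)
  split c = trans (xorSum-punchIn (λ x → s x ∧ v x c) p)
    (cong₂ (λ a b → (a ∧ v p c) xor b) (insertAt-lookup s′ p σ)
           (xorSum-cong (λ j → cong (_∧ v (punchIn p j) c) (insertAt-punchIn s′ p σ j))))
  vanishes : ∀ c → xorSum (λ x → s x ∧ v x c) ≡ false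
  vanishes zero = begin
    xorSum (λ x → s x ∧ v x zero) ≡⟨ split zero ⟩
    (σ ∧ v p zero) xor σ          ≡⟨ cong (λ b → (σ ∧ b) xor σ) vp₀ ⟩
    (σ ∧ true) xor σ              ≡⟨ cong (_xor σ) (∧-identityʳ σ) ⟩
    σ xor σ                       ≡⟨ xor-same σ ⟩
    false                         ∎
    where open ≡-Reasoning
  vanishes (suc c) = begin
    xorSum (λ x → s x ∧ v x (suc c))     ≡⟨ split (suc c) ⟩
    (σ ∧ v p (suc c)) xor A              ≡⟨ xor-comm _ A ⟩
    A xor (σ ∧ v p (suc c))
      ≡⟨ cong (A xor_) (sym (xorSum-∧ʳ (v p (suc c)) (λ j → s′ j ∧ v (punchIn p j) zero))) ⟩
    A xor xorSum (λ j → (s′ j ∧ v (punchIn p j) zero) ∧ v p (suc c))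
      ≡⟨ sym (xorSum-xor (λ j → s′ j ∧ v (punchIn p j) (suc c)) _) ⟩
    xorSum (λ j → (s′ j ∧ v (punchIn p j) (suc c)) xor ((s′ j ∧ v (punchIn p j) zero) ∧ v p (suc c)))
      ≡⟨ xorSum-cong (λ j → sym (trans (∧-distribˡ-xor (s′ j) _ _)
                                   (cong ((s′ j ∧ v (punchIn p j) (suc c)) xor_) (sym (∧-assoc (s′ j) _ _))))) ⟩
    xorSum (λ j → s′ j ∧ u j c)          ≡⟨ proj₂ (proj₂ relation) c ⟩
    false                                ∎
    where
    open ≡-Reasoning
    A = xorSum (λ j → s′ j ∧ v (punchIn p j) (suc c))

≡ᵇ-refl : ∀ a → (a ≡ᵇ a) ≡ true
≡ᵇ-refl zero    = refl
≡ᵇ-refl (suc a) = ≡ᵇ-refl a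

<ᵇ-true : ∀ {a b} → a < b → (a <ᵇ b) ≡ true
<ᵇ-true {zero}  {suc b} _         = refl
<ᵇ-true {suc a} {suc b} (s≤s a<b) = <ᵇ-true a<b

<ᵇ-false : ∀ {a b} → b ≤ a → (a <ᵇ b) ≡ false
<ᵇ-false {a}     {zero}  _         = refl
<ᵇ-false {suc a} {suc b} (s≤s b≤a) = <ᵇ-false b≤a

<ᵇ-true⇒< : ∀ a b → (a <ᵇ b) ≡ true → a < b
<ᵇ-true⇒< zero    (suc b) _ = s≤s z≤n
<ᵇ-true⇒< (suc a) (suc b) e = s≤s (<ᵇ-true⇒< a b e)

<ᵇ-false⇒≥ : ∀ a b → (a <ᵇ b) ≡ false → b ≤ a
<ᵇ-false⇒≥ a       zero    _ = z≤n
<ᵇ-false⇒≥ (suc a) (suc b) e = s≤s (<ᵇ-false⇒≥ a b e)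

≡ᵇ-true⇒≡ : ∀ a b → (a ≡ᵇ b) ≡ true → a ≡ b
≡ᵇ-true⇒≡ zero    zero    _ = refl
≡ᵇ-true⇒≡ (suc a) (suc b) e = cong suc (≡ᵇ-true⇒≡ a b e)

≢⇒≡ᵇ-false : ∀ {a b} → a ≢ b → (a ≡ᵇ b) ≡ false
≢⇒≡ᵇ-false {zero}  {zero}  a≢b = contradiction refl a≢b
≢⇒≡ᵇ-false {zero}  {suc b} _   = refl
≢⇒≡ᵇ-false {suc a} {zero}  _   = refl
≢⇒≡ᵇ-false {suc a} {suc b} a≢b = ≢⇒≡ᵇ-false (a≢b ∘ cong suc)

≡ᵇ-false⇒≢ : ∀ a b → (a ≡ᵇ b) ≡ false → a ≢ b
≡ᵇ-false⇒≢ a .a e refl = contradiction (trans (sym (≡ᵇ-refl a)) e) λ ()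

+suc≡⇒< : ∀ {m e n} → m + suc e ≡ n → m < n
+suc≡⇒< {m} {e} refl = ≤-trans (s≤s (m≤m+n m e)) (≤-reflexive (sym (+-suc m e)))

xor-≡false : ∀ x {y} → y ≡ false → x xor y ≡ x
xor-≡false x refl = xor-identityʳ x

xor-≡false-both : ∀ x y → (x ∧ false) xor (y ∧ false) ≡ false
xor-≡false-both x y rewrite ∧-zeroʳ x | ∧-zeroʳ y = refl

xorBelow : ℕ → (ℕ → Bool) → Bool
xorBelow zero    g = false
xorBelow (suc m) g = xorBelow m g xor g m

xorBelow-suc : ∀ m (g : ℕ → Bool) → xorBelow (suc m) g ≡ g 0 xor xorBelow m (λ l → g (suc l))
xorBelow-suc zero    g = xor-comm false (g 0)
xorBelow-suc (suc m) g = begin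
  (xorBelow m g xor g m) xor g (suc m)
    ≡⟨ cong (λ e → e xor g (suc m)) (xorBelow-suc m g) ⟩
  (g 0 xor xorBelow m (λ l → g (suc l))) xor g (suc m)
    ≡⟨ xor-assoc (g 0) _ _ ⟩
  g 0 xor (xorBelow m (λ l → g (suc l)) xor g (suc m)) ∎
  where open ≡-Reasoning

xorSum≡xorBelow : ∀ {m} (g : ℕ → Bool) → xorSum {m} (λ l → g (toℕ l)) ≡ xorBelow m g
xorSum≡xorBelow {zero}  g = refl
xorSum≡xorBelow {suc m} g =
  trans (cong (g 0 xor_) (xorSum≡xorBelow {m} (λ l → g (suc l)))) (sym (xorBelow-suc m g))

extendℕ : ∀ {r} → (Fin r → Bool) → ℕ → Bool
extendℕ {zero}  f l       = false
extendℕ {suc r} f zero    = f zero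
extendℕ {suc r} f (suc l) = extendℕ (λ x → f (suc x)) l

extendℕ-toℕ : ∀ {r} (f : Fin r → Bool) (j : Fin r) → extendℕ f (toℕ j) ≡ f j
extendℕ-toℕ f zero    = refl
extendℕ-toℕ f (suc j) = extendℕ-toℕ (λ x → f (suc x)) j

xorSum≡xorBelow-extendℕ : ∀ {r} (f g : Fin r → Bool) →
  xorSum (λ l → f l ∧ g l) ≡ xorBelow r (λ l → extendℕ f l ∧ extendℕ g l)
xorSum≡xorBelow-extendℕ {r} f g =
  trans (xorSum-cong (λ l → sym (cong₂ _∧_ (extendℕ-toℕ f l) (extendℕ-toℕ g l))))
        (xorSum≡xorBelow {r} (λ l → extendℕ f l ∧ extendℕ g l))

extendℕ-cong : ∀ {r} {f g : Fin r → Bool} → (∀ j → f j ≡ g j) → ∀ j → extendℕ f j ≡ extendℕ g j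
extendℕ-cong {zero}  f≗g j       = refl
extendℕ-cong {suc r} f≗g zero    = f≗g zero
extendℕ-cong {suc r} f≗g (suc j) = extendℕ-cong (λ j → f≗g (suc j)) j

xorBelow-false : ∀ m → xorBelow m (λ _ → false) ≡ false
xorBelow-false zero    = refl
xorBelow-false (suc m) = trans (xor-identityʳ _) (xorBelow-false m)

extendℕ-xorSum : ∀ {s r} (M : Fin s → Fin r → Bool) (v : Fin r → Bool) j →
  extendℕ (λ i → xorSum (λ l → M i l ∧ v l)) j ≡ xorBelow r (λ l → extendℕ (λ i → extendℕ (M i) l) j ∧ extendℕ v l)
extendℕ-xorSum {zero}  {r} M v j       = sym (xorBelow-false r)
extendℕ-xorSum {suc s}     M v zero    = xorSum≡xorBelow-extendℕ (M zero) v
extendℕ-xorSum {suc s}     M v (suc j) = extendℕ-xorSum (λ i → M (suc i)) v j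

extendℕ-true : ∀ {r} (f : Fin r → Bool) j → extendℕ f j ≡ true → Σ (Fin r) λ j′ → toℕ j′ ≡ j × f j′ ≡ true
extendℕ-true {suc r} f zero    e = zero , refl , e
extendℕ-true {suc r} f (suc j) e with extendℕ-true (λ x → f (suc x)) j e
... | j′ , refl , f-j′ = suc j′ , refl , f-j′

-- Pivot-minors

-- Entry x y of G ∧ uv for x, y ∉ {u, v}, as the three local complementations compute it,
-- where a = G x u, b = G x v, c = G y u, d = G y v and G u v = 1.
pivot-entry-identity : ∀ a b c d →
  (a ∧ c) xor (((b xor a ∧ true) ∧ (d xor c ∧ true)) xor
    (((a xor a ∧ false) xor (b xor a ∧ true) ∧ true) ∧ ((c xor c ∧ false) xor (d xor c ∧ true) ∧ true)))
  ≡ (a ∧ d) xor (b ∧ c)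
pivot-entry-identity false false false false = refl
pivot-entry-identity false false false true  = refl
pivot-entry-identity false false true  false = refl
pivot-entry-identity false false true  true  = refl
pivot-entry-identity false true  false false = refl
pivot-entry-identity false true  false true  = refl
pivot-entry-identity false true  true  false = refl
pivot-entry-identity false true  true  true  = refl
pivot-entry-identity true  false false false = refl
pivot-entry-identity true  false false true  = refl
pivot-entry-identity true  false true  false = refl
pivot-entry-identity true  false true  true  = refl
pivot-entry-identity true  true  false false = refl
pivot-entry-identity true  true  false true  = refl
pivot-entry-identity true  true  true  false = refl
pivot-entry-identity true  true  true  true  = refl

pivot-formula : ∀ {m} (G : Adj (suc (suc m))) → IsSimple G → G zero (suc zero) ≡ true → ∀ x y →
  pivot G zero (suc zero) (suc (suc x)) (suc (suc y)) ≡
    G (suc (suc x)) (suc (suc y)) xor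
      ((G (suc (suc x)) zero ∧ G (suc (suc y)) (suc zero)) xor (G (suc (suc x)) (suc zero) ∧ G (suc (suc y)) zero))
pivot-formula G (symm , loop) uv x y
  rewrite loop zero | uv | trans (symm (suc zero) zero) uv
  with suc (suc x) ≟ suc (suc y)
... | yes refl rewrite loop (suc (suc x)) = sym (trans (cong (_xor_ (a ∧ b)) (∧-comm b a)) (xor-same (a ∧ b)))
  where a = G (suc (suc x)) zero
        b = G (suc (suc x)) (suc zero)
... | no _ = trans (xor-assoc (e xor (a ∧ c)) _ _) (trans (xor-assoc e (a ∧ c) _)
  (cong (e xor_) (pivot-entry-identity a b c d)))
  where a = G (suc (suc x)) zero
        b = G (suc (suc x)) (suc zero)
        c = G (suc (suc y)) zero
        d = G (suc (suc y)) (suc zero)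
        e = G (suc (suc x)) (suc (suc y))

infix 4 _≗ᴳ_
_≗ᴳ_ : ∀ {m} → Adj m → Adj m → Set
G ≗ᴳ H = ∀ x y → G x y ≡ H x y

PivotMinor-trans : ∀ {a b c} {A : Adj a} {B : Adj b} {C : Adj c} →
  PivotMinor A B → PivotMinor B C → PivotMinor A C
PivotMinor-trans A≼B pm-refl              = A≼B
PivotMinor-trans A≼B (pm-pivot u v e B≼C) = pm-pivot u v e (PivotMinor-trans A≼B B≼C)
PivotMinor-trans A≼B (pm-del v B≼C)       = pm-del v (PivotMinor-trans A≼B B≼C)

localComp-cong : ∀ {m} {G H : Adj m} → G ≗ᴳ H → ∀ v → localComp G v ≗ᴳ localComp H v
localComp-cong G≗H v x y rewrite G≗H x y | G≗H x v | G≗H y v = refl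

pivot-cong : ∀ {m} {G H : Adj m} → G ≗ᴳ H → ∀ u v → pivot G u v ≗ᴳ pivot H u v
pivot-cong G≗H u v = localComp-cong (localComp-cong (localComp-cong G≗H u) v) u

-- Up to pointwise equality, since deletions only produce the intended adjacency pointwise.
HasPivotMinor : ∀ {m p} → Adj m → Adj p → Set
HasPivotMinor {m} {p} G F = Σ (Adj p) λ F′ → PivotMinor F′ G × F′ ≗ᴳ F

PivotMinor-resp-≗ᴳ : ∀ {a b} {F : Adj a} {G H : Adj b} → PivotMinor F H → G ≗ᴳ H → HasPivotMinor G F
PivotMinor-resp-≗ᴳ {G = G} pm-refl G≗H = G , pm-refl , G≗H
PivotMinor-resp-≗ᴳ (pm-pivot u v e F≼H) G≗H
  with PivotMinor-resp-≗ᴳ F≼H (pivot-cong G≗H u v)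
... | F′ , F′≼G , F′≗F = F′ , pm-pivot u v (trans (G≗H u v) e) F′≼G , F′≗F
PivotMinor-resp-≗ᴳ (pm-del v F≼H) G≗H
  with PivotMinor-resp-≗ᴳ F≼H (λ x y → G≗H _ _)
... | F′ , F′≼G , F′≗F = F′ , pm-del v F′≼G , F′≗F

HasPivotMinor-≗ᴳ : ∀ {m} {G F : Adj m} → G ≗ᴳ F → HasPivotMinor G F
HasPivotMinor-≗ᴳ {G = G} G≗F = G , pm-refl , G≗F

HasPivotMinor-trans : ∀ {a b c} {A : Adj a} {B : Adj b} {C : Adj c} →
  HasPivotMinor A B → HasPivotMinor B C → HasPivotMinor A C
HasPivotMinor-trans (B′ , B′≼A , B′≗B) (C′ , C′≼B , C′≗C)
  with PivotMinor-resp-≗ᴳ C′≼B B′≗B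
... | C″ , C″≼B′ , C″≗C′ = C″ , PivotMinor-trans C″≼B′ B′≼A , λ x y → trans (C″≗C′ x y) (C′≗C x y)

pivot-delete-first-two : ∀ {m} (G : Adj (suc (suc m))) → IsSimple G → G zero (suc zero) ≡ true →
  HasPivotMinor G (λ x y → G (suc (suc x)) (suc (suc y)) xor
    ((G (suc (suc x)) zero ∧ G (suc (suc y)) (suc zero)) xor (G (suc (suc x)) (suc zero) ∧ G (suc (suc y)) zero)))
pivot-delete-first-two G simple uv =
  deleteV (deleteV (pivot G zero (suc zero)) zero) zero ,
  pm-pivot zero (suc zero) uv (pm-del zero (pm-del zero pm-refl)) ,
  pivot-formula G simple uv

-- Sweeping a cut along a vertex ordering

lastTrue : ∀ {r} (s : Fin r → Bool) {i : Fin r} → s i ≡ true →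
  Σ (Fin r) λ d → s d ≡ true × (∀ j → s j ≡ true → toℕ j ≤ toℕ d)
lastTrue {suc r} s {i} sᵢ with any? (λ j → s (suc j) Data.Bool.≟ true)
... | yes (j , sⱼ) with lastTrue (λ j → s (suc j)) sⱼ
...   | d , s-d , last = suc d , s-d , λ { zero _ → z≤n ; (suc j) e → s≤s (last j e) }
lastTrue {suc r} s {zero}  s₀ | no none = zero , s₀ , λ { zero _ → z≤n ; (suc j) e → ⊥-elim (none (j , e)) }
lastTrue {suc r} s {suc i} sᵢ | no none = ⊥-elim (none (i , sᵢ))

xor≡false⇒≡ : ∀ {a b} → a xor b ≡ false → a ≡ b
xor≡false⇒≡ {true}  {true}  _ = refl
xor≡false⇒≡ {false} {false} _ = refl

UpperTriangular : ∀ {k} → (Fin k → Fin k → Bool) → Set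
UpperTriangular {k} T = ∀ (j l : Fin k) → T j l ≡ true → toℕ j ≤ toℕ l

-- A a b is the adjacency of the vertices at positions a and b of a vertex ordering.
module CutBases (n k′ : ℕ) (A : ℕ → ℕ → Bool) where

  k : ℕ
  k = suc k′

  CutRankAt≤ : ℕ → Set
  CutRankAt≤ i = Σ (Fin k → ℕ → Bool) λ W → ∀ a → a < i → Σ (Fin k → Bool) λ γ →
    ∀ b → i ≤ b → b < n → A a b ≡ xorSum (λ l → γ l ∧ W l b)

  record CutBasis (i : ℕ) : Set where
    field
      row    : Fin k → ℕ
      row<   : ∀ l → row l < i
      coeff  : ℕ → Fin k → Bool
      spans  : ∀ a b → a < i → i ≤ b → b < n → A a b ≡ xorSum (λ l → coeff a l ∧ A (row l) b)
  open CutBasis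

  record BasisStep (i : ℕ) (D : CutBasis i) : Set where
    field
      next       : CutBasis (suc i)
      transition : Fin k → Fin k → Bool
      coeff-next : ∀ a → a < i → ∀ j → coeff next a j ≡ xorSum (λ l → transition j l ∧ coeff D a l)
      upper      : UpperTriangular transition

  initialBasis : CutBasis 1
  initialBasis = record
    { row = λ _ → 0 ; row< = λ _ → s≤s z≤n ; coeff = λ _ l → δ l zero
    ; spans = λ { .0 b (s≤s z≤n) _ _ → sym (xorSum-δʳ {k} zero (λ _ → A 0 b)) } }

  module _ {i : ℕ} (D : CutBasis i) where

    keepBasis : (s : Fin k → Bool) →
      (∀ b → suc i ≤ b → b < n → A i b ≡ xorSum (λ l → s l ∧ A (row D l) b)) → BasisStep i D
    keepBasis s rowᵢ = record
      { next = record { row = row D ; row< = λ l → m≤n⇒m≤1+n (row< D l) ; coeff = coeff′ ; spans = spans′ }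
      ; transition = δ
      ; coeff-next = λ a a<i j → trans (cong (λ e → if e then s j else coeff D a j) (≢⇒≡ᵇ-false (<⇒≢ a<i)))
                                       (sym (xorSum-δˡ j (coeff D a)))
      ; upper = λ j l e → subst (λ l → toℕ j ≤ toℕ l) (δ-sound j l e) ≤-refl }
      where
      coeff′ : ℕ → Fin k → Bool
      coeff′ a l = if a ≡ᵇ i then s l else coeff D a l
      spans′ : ∀ a b → a < suc i → suc i ≤ b → b < n → A a b ≡ xorSum (λ l → coeff′ a l ∧ A (row D l) b)
      spans′ a b a≤i i<b b<n with m<1+n⇒m<n∨m≡n a≤i
      ... | inj₂ refl rewrite ≡ᵇ-refl a = rowᵢ b i<b b<n
      ... | inj₁ a<i  rewrite ≢⇒≡ᵇ-false (<⇒≢ a<i) = spans D a b a<i (<⇒≤ i<b) b<n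

    -- Row i replaces the last row d of a relation among the rows of D; taking d last makes the
    -- transition upper triangular.
    exchangeBasis : (s : Fin k → Bool) (d : Fin k) → s d ≡ true → (∀ j → s j ≡ true → toℕ j ≤ toℕ d) →
      (∀ b → suc i ≤ b → b < n → xorSum (λ l → s l ∧ A (row D l) b) ≡ false) → BasisStep i D
    exchangeBasis s d s-d last relation = record
      { next = record { row = row′ ; row< = row′< ; coeff = coeff′ ; spans = spans′ }
      ; transition = T
      ; coeff-next = coeff-next′
      ; upper = upper′ }
      where
      row′ : Fin k → ℕ
      row′ l = if δ l d then i else row D l
      row′< : ∀ l → row′ l < suc i
      row′< l with δ l d
      ... | true  = ≤-refl
      ... | false = m≤n⇒m≤1+n (row< D l)
      coeff′ : ℕ → Fin k → Bool
      coeff′ a l = if a ≡ᵇ i then δ l d else coeff D a l xor (coeff D a d ∧ s l)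
      T : Fin k → Fin k → Bool
      T j l = δ j l xor (δ l d ∧ s j)
      term : ∀ a → a < i → ∀ b l →
        coeff′ a l ∧ A (row′ l) b ≡ (coeff D a l xor (coeff D a d ∧ s l)) ∧ A (row D l) b
      term a a<i b l rewrite ≢⇒≡ᵇ-false (<⇒≢ a<i) with δ l d in l≡d
      ... | true rewrite δ-sound l d l≡d | s-d | ∧-identityʳ (coeff D a d) | xor-same (coeff D a d) = refl
      ... | false = refl
      spans′ : ∀ a b → a < suc i → suc i ≤ b → b < n → A a b ≡ xorSum (λ l → coeff′ a l ∧ A (row′ l) b)
      spans′ a b a≤i i<b b<n with m<1+n⇒m<n∨m≡n a≤i
      ... | inj₂ refl rewrite ≡ᵇ-refl a =
        sym (trans (xorSum-δʳ d (λ l → A (row′ l) b)) (cong (λ e → A (if e then a else row D d) b) (δ-refl d)))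
      ... | inj₁ a<i = sym (begin
        xorSum (λ l → coeff′ a l ∧ A (row′ l) b)
          ≡⟨ xorSum-cong (term a a<i b) ⟩
        xorSum (λ l → (coeff D a l xor (c ∧ s l)) ∧ A (row D l) b)
          ≡⟨ xorSum-cong (λ l → ∧-distribʳ-xor (A (row D l) b) (coeff D a l) (c ∧ s l)) ⟩
        xorSum (λ l → (coeff D a l ∧ A (row D l) b) xor ((c ∧ s l) ∧ A (row D l) b))
          ≡⟨ xorSum-xor (λ l → coeff D a l ∧ A (row D l) b) (λ l → (c ∧ s l) ∧ A (row D l) b) ⟩
        old xor xorSum (λ l → (c ∧ s l) ∧ A (row D l) b)
          ≡⟨ cong (old xor_) (trans (xorSum-cong (λ l → ∧-assoc c (s l) (A (row D l) b)))
                                    (xorSum-∧ˡ c (λ l → s l ∧ A (row D l) b))) ⟩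
        old xor (c ∧ xorSum (λ l → s l ∧ A (row D l) b))
          ≡⟨ cong (λ e → old xor (c ∧ e)) (relation b i<b b<n) ⟩
        old xor (c ∧ false)
          ≡⟨ trans (cong (old xor_) (∧-zeroʳ c)) (xor-identityʳ old) ⟩
        old
          ≡⟨ sym (spans D a b a<i (<⇒≤ i<b) b<n) ⟩
        A a b ∎)
        where
        open ≡-Reasoning
        c = coeff D a d
        old = xorSum (λ l → coeff D a l ∧ A (row D l) b)
      coeff-next′ : ∀ a → a < i → ∀ j → coeff′ a j ≡ xorSum (λ l → T j l ∧ coeff D a l)
      coeff-next′ a a<i j rewrite ≢⇒≡ᵇ-false (<⇒≢ a<i) = sym (begin
        xorSum (λ l → (δ j l xor (δ l d ∧ s j)) ∧ coeff D a l)
          ≡⟨ xorSum-cong (λ l → ∧-distribʳ-xor (coeff D a l) (δ j l) (δ l d ∧ s j)) ⟩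
        xorSum (λ l → (δ j l ∧ coeff D a l) xor ((δ l d ∧ s j) ∧ coeff D a l))
          ≡⟨ xorSum-xor (λ l → δ j l ∧ coeff D a l) (λ l → (δ l d ∧ s j) ∧ coeff D a l) ⟩
        xorSum (λ l → δ j l ∧ coeff D a l) xor xorSum (λ l → (δ l d ∧ s j) ∧ coeff D a l)
          ≡⟨ cong₂ _xor_ (xorSum-δˡ j (coeff D a))
               (trans (xorSum-cong (λ l → ∧-assoc (δ l d) (s j) (coeff D a l)))
                      (xorSum-δʳ d (λ l → s j ∧ coeff D a l))) ⟩
        coeff D a j xor (s j ∧ coeff D a d)
          ≡⟨ cong (coeff D a j xor_) (∧-comm (s j) (coeff D a d)) ⟩
        coeff D a j xor (coeff D a d ∧ s j) ∎)
        where open ≡-Reasoning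
      upper′ : UpperTriangular T
      upper′ j l e with δ j l in j≡l
      ... | true rewrite δ-sound j l j≡l = ≤-refl
      ... | false with δ l d in l≡d | s j in s-j
      ...   | true | true rewrite δ-sound l d l≡d = last j s-j

  -- the k + 1 rows i, row D 0, …, row D (k-1) are dependent right of the cut at i + 1
  dependentRowsStep : ∀ {i} (D : CutBasis i) → CutRankAt≤ (suc i) → BasisStep i D
  dependentRowsStep {i} D (W , cut) = fromRelation (linearlyDependent ≤-refl γ)
    where
    rowAt : Fin (suc k) → ℕ
    rowAt zero    = i
    rowAt (suc l) = row D l
    rowAt< : ∀ x → rowAt x < suc i
    rowAt< zero    = ≤-refl
    rowAt< (suc l) = m≤n⇒m≤1+n (row< D l)
    γ : Fin (suc k) → Fin k → Bool
    γ x = proj₁ (cut (rowAt x) (rowAt< x))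
    rowRelation : (s : Fin (suc k) → Bool) → (∀ c → xorSum (λ x → s x ∧ γ x c) ≡ false) →
      ∀ b → suc i ≤ b → b < n → xorSum (λ x → s x ∧ A (rowAt x) b) ≡ false
    rowRelation s vanishes b i<b b<n = begin
      xorSum (λ x → s x ∧ A (rowAt x) b)
        ≡⟨ xorSum-cong (λ x → cong (s x ∧_) (proj₂ (cut (rowAt x) (rowAt< x)) b i<b b<n)) ⟩
      xorSum (λ x → s x ∧ xorSum (λ l → γ x l ∧ W l b))
        ≡⟨ xorSum-cong (λ x → sym (xorSum-∧ˡ (s x) (λ l → γ x l ∧ W l b))) ⟩
      xorSum (λ x → xorSum (λ l → s x ∧ (γ x l ∧ W l b)))
        ≡⟨ xorSum-swap (λ x l → s x ∧ (γ x l ∧ W l b)) ⟩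
      xorSum (λ l → xorSum (λ x → s x ∧ (γ x l ∧ W l b)))
        ≡⟨ xorSum-cong (λ l → trans (xorSum-cong (λ x → sym (∧-assoc (s x) (γ x l) (W l b))))
                                     (xorSum-∧ʳ (W l b) (λ x → s x ∧ γ x l))) ⟩
      xorSum (λ l → xorSum (λ x → s x ∧ γ x l) ∧ W l b)
        ≡⟨ xorSum-false (λ l → cong (_∧ W l b) (vanishes l)) ⟩
      false ∎
      where open ≡-Reasoning
    fromRelation : NontrivialRelation γ → BasisStep i D
    fromRelation (s , (x₀ , s-x₀) , vanishes) = byFirstCoefficient (s zero) refl
      where
      relation = rowRelation s vanishes
      rest : ℕ → Bool
      rest b = xorSum (λ l → s (suc l) ∧ A (row D l) b)
      byFirstCoefficient : ∀ σ → s zero ≡ σ → BasisStep i D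
      byFirstCoefficient true s₀ = keepBasis D (λ l → s (suc l)) λ b i<b b<n →
        xor≡false⇒≡ (subst (λ σ → (σ ∧ A i b) xor rest b ≡ false) s₀ (relation b i<b b<n))
      byFirstCoefficient false s₀ = exchangeBasis D (λ l → s (suc l)) d s-d last λ b i<b b<n →
        subst (λ σ → (σ ∧ A i b) xor rest b ≡ false) s₀ (relation b i<b b<n)
        where
        nonzeroRow : ∀ x → s x ≡ true → Σ (Fin k) λ l → s (suc l) ≡ true
        nonzeroRow zero    s-0 = contradiction (trans (sym s-0) s₀) λ ()
        nonzeroRow (suc l) s-l = l , s-l
        lastRow = lastTrue (λ l → s (suc l)) (proj₂ (nonzeroRow x₀ s-x₀))
        d = proj₁ lastRow
        s-d = proj₁ (proj₂ lastRow)
        last = proj₂ (proj₂ lastRow)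

  -- opaque so that the iterated bases do not unfold during type checking
  opaque
    basisStep : ∀ {i} (D : CutBasis i) → CutRankAt≤ (suc i) → BasisStep i D
    basisStep = dependentRowsStep

-- Stage c is the cut between the positions ≤ c + 1 and ≥ c + 2: there the rows a ≤ c + 1 of A are
-- the combinations coeff c a of the k rows basisRow c, and transition c relates the coefficients
-- at the stages c and c + 1.
record CutSequence (n k : ℕ) (A : ℕ → ℕ → Bool) : Set where
  field
    coeff      : ℕ → ℕ → ℕ → Bool
    basisRow   : ℕ → ℕ → ℕ → Bool
    transition : ℕ → ℕ → ℕ → Bool
    spans      : ∀ c a b → a < 2 + c → 2 + c ≤ b → b < n →
                 A a b ≡ xorBelow k (λ l → coeff c a l ∧ basisRow c l b)
    coeff-suc  : ∀ c a j → a < 2 + c →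
                 coeff (suc c) a j ≡ xorBelow k (λ l → transition c j l ∧ coeff c a l)
    transition-upper : ∀ c j l → transition c j l ≡ true → j ≤ l × l < k

module _ (n k′ : ℕ) (A : ℕ → ℕ → Bool) where
  open CutBases n k′ A
  open CutBasis
  open BasisStep

  module _ (cut : ∀ i → CutRankAt≤ i) where

    basis : ∀ i → CutBasis (suc i)
    basis zero    = initialBasis
    basis (suc i) = next (basisStep (basis i) (cut (2 + i)))

    step : ∀ c → BasisStep (2 + c) (basis (suc c))
    step c = basisStep (basis (suc c)) (cut (3 + c))

    cutSequence : CutSequence n k A
    cutSequence = record
      { coeff      = λ c a → extendℕ (coeff (basis (suc c)) a)
      ; basisRow   = λ c l b → extendℕ (λ l′ → A (row (basis (suc c)) l′) b) l
      ; transition = λ c j l → extendℕ (λ j′ → extendℕ (transition (step c) j′) l) j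
      ; spans      = spans′
      ; coeff-suc  = λ c a j a<c+2 →
          trans (extendℕ-cong (coeff-next (step c) a a<c+2) j)
                (extendℕ-xorSum (transition (step c)) (coeff (basis (suc c)) a) j)
      ; transition-upper = upper′
      }
      where
      spans′ : ∀ c a b → a < 2 + c → 2 + c ≤ b → b < n →
        A a b ≡ xorBelow k (λ l → extendℕ (coeff (basis (suc c)) a) l ∧ extendℕ (λ l′ → A (row (basis (suc c)) l′) b) l)
      spans′ c a b a<c+2 c+2≤b b<n =
        trans (spans (basis (suc c)) a b a<c+2 c+2≤b b<n)
              (xorSum≡xorBelow-extendℕ (coeff (basis (suc c)) a) (λ l′ → A (row (basis (suc c)) l′) b))
      upper′ : ∀ c j l → extendℕ (λ j′ → extendℕ (transition (step c) j′) l) j ≡ true → j ≤ l × l < k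
      upper′ c j l e with extendℕ-true (λ j′ → extendℕ (transition (step c) j′) l) j e
      ... | j′ , refl , e′ with extendℕ-true (transition (step c) j′) l e′
      ...   | l′ , refl , e″ = upper (step c) j′ l′ e″ , toℕ<n l′

-- G read along the vertex ordering σ, as a matrix indexed by positions (false outside 0 … n-1)
module Ordered {n′} (G : Adj (suc n′)) (G-simple : IsSimple G) (σ : Fin (suc n′) ↔ Fin (suc n′)) where

  n : ℕ
  n = suc n′

  opaque
    position : ℕ → Fin n
    position b with b <? n
    ... | yes b<n = fromℕ< b<n
    ... | no  _   = zero

    toℕ-position : ∀ b → b < n → toℕ (position b) ≡ b
    toℕ-position b b<n with b <? n
    ... | yes b<n′ = toℕ-fromℕ< b<n′
    ... | no  b≮n  = contradiction b<n b≮n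

    position-toℕ : ∀ x → position (toℕ x) ≡ x
    position-toℕ x with toℕ x <? n
    ... | yes x<n = fromℕ<-toℕ x x<n
    ... | no  x≮n = contradiction (toℕ<n x) x≮n

  vertexAt : ℕ → Fin n
  vertexAt b = Inverse.to σ (position b)

  A : ℕ → ℕ → Bool
  A a b = (a <ᵇ n) ∧ ((b <ᵇ n) ∧ G (vertexAt a) (vertexAt b))

  A-inside : ∀ a b → a < n → b < n → A a b ≡ G (vertexAt a) (vertexAt b)
  A-inside a b a<n b<n rewrite <ᵇ-true a<n | <ᵇ-true b<n = refl

  A-sym : ∀ a b → A a b ≡ A b a
  A-sym a b with a <ᵇ n | b <ᵇ n
  ... | true  | true  = proj₁ G-simple _ _
  ... | true  | false = refl
  ... | false | true  = refl
  ... | false | false = refl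

  A-loop : ∀ a → A a a ≡ false
  A-loop a rewrite proj₂ G-simple (vertexAt a) | ∧-zeroʳ (a <ᵇ n) = ∧-zeroʳ (a <ᵇ n)

  A-toℕ : ∀ x y → A (toℕ x) (toℕ y) ≡ G (Inverse.to σ x) (Inverse.to σ y)
  A-toℕ x y = trans (A-inside (toℕ x) (toℕ y) (toℕ<n x) (toℕ<n y))
    (cong₂ (λ u v → G (Inverse.to σ u) (Inverse.to σ v)) (position-toℕ x) (position-toℕ y))

  prefix-vertexAt : ∀ i a → a < n → prefix σ i (vertexAt a) ≡ (a <ᵇ i)
  prefix-vertexAt i a a<n =
    trans (cong (λ x → toℕ x <ᵇ i) (Inverse.strictlyInverseʳ σ (position a))) (cong (_<ᵇ i) (toℕ-position a a<n))

  module _ (k′ : ℕ) (prefixRank : ∀ i → 1 ≤ i → i < n → CutRank≤ G (prefix σ i) (suc k′)) where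
    open CutBases n k′ A

    cutRankAt : ∀ i → CutRankAt≤ i
    cutRankAt i with 1 ≤? i | i <? n
    ... | no 1≰i | _ = (λ _ _ → false) , λ a a<i → contradiction (≤-trans (s≤s z≤n) a<i) 1≰i
    ... | yes _  | no i≮n = (λ _ _ → false) , λ a a<i → (λ _ → false) , λ b i≤b b<n → contradiction (≤-<-trans i≤b b<n) i≮n
    ... | yes 1≤i | yes i<n with prefixRank i 1≤i i<n
    ...   | w , rows = (λ l b → w l (vertexAt b)) , λ a a<i → γ a a<i , λ b i≤b b<n →
      trans (A-inside a b (<-trans a<i i<n) b<n)
            (proj₂ (rows (vertexAt a) (left a a<i)) (vertexAt b) (trans (prefix-vertexAt i b b<n) (<ᵇ-false i≤b)))
      where
      left : ∀ a → a < i → prefix σ i (vertexAt a) ≡ true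
      left a a<i = trans (prefix-vertexAt i a (<-trans a<i i<n)) (<ᵇ-true a<i)
      γ : ∀ a → a < i → Fin k → Bool
      γ a a<i = proj₁ (rows (vertexAt a) (left a a<i))

-- The graph H and its pivots

∨-true⇒ : ∀ {a b} → a ∨ b ≡ true → a ≡ true ⊎ b ≡ true
∨-true⇒ {true}  _ = inj₁ refl
∨-true⇒ {false} e = inj₂ e

∧-true⇒ : ∀ {a b} → a ∧ b ≡ true → a ≡ true × b ≡ true
∧-true⇒ {true} {true} _ = refl , refl

isPair : ℕ → ℕ → ℕ → ℕ → Bool
isPair a b u v = ((a ≡ᵇ u) ∧ (b ≡ᵇ v)) ∨ ((a ≡ᵇ v) ∧ (b ≡ᵇ u))

isPair-sym : ∀ a b u v → isPair a b u v ≡ isPair b a u v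
isPair-sym a b u v rewrite ∧-comm (a ≡ᵇ u) (b ≡ᵇ v) | ∧-comm (a ≡ᵇ v) (b ≡ᵇ u) =
  ∨-comm ((b ≡ᵇ v) ∧ (a ≡ᵇ u)) _

isPair-true : ∀ a b u v → isPair a b u v ≡ true → (a ≡ u × b ≡ v) ⊎ (a ≡ v × b ≡ u)
isPair-true a b u v e with ∨-true⇒ e
... | inj₁ e₁ = inj₁ (≡ᵇ-true⇒≡ a u (proj₁ (∧-true⇒ e₁)) , ≡ᵇ-true⇒≡ b v (proj₂ (∧-true⇒ e₁)))
... | inj₂ e₂ = inj₂ (≡ᵇ-true⇒≡ a v (proj₁ (∧-true⇒ e₂)) , ≡ᵇ-true⇒≡ b u (proj₂ (∧-true⇒ e₂)))

isPair-refl : ∀ u v → isPair u v u v ≡ true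
isPair-refl u v rewrite ≡ᵇ-refl u | ≡ᵇ-refl v = refl

data Node : Set where
  vtx        : ℕ → Node
  pvtx qvtx  : ℕ → ℕ → Node

pivotRule : (Node → Node → Bool) → Node → Node → Node → Node → Bool
pivotRule R P Q x y = R x y xor ((R x P ∧ R y Q) xor (R x Q ∧ R y P))

module Layout (t k : ℕ) where

  n : ℕ
  n = 3 + t

  -- the p- and q-vertices of stage c′ not yet pivoted after λ′ pivots of stage c
  PendingAt : ℕ → ℕ → ℕ → ℕ → Set
  PendingAt c λ′ c′ l = l < k × c′ < t × (c < c′ ⊎ (c ≡ c′ × λ′ ≤ l))

  Pending : ℕ → ℕ → Node → Set
  Pending c λ′ (vtx a)     = a < n
  Pending c λ′ (pvtx c′ l) = PendingAt c λ′ c′ l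
  Pending c λ′ (qvtx c′ l) = PendingAt c λ′ c′ l

  PendingAt-suc⇒ : ∀ {c λ′ c′ l} → PendingAt c (suc λ′) c′ l → PendingAt c λ′ c′ l
  PendingAt-suc⇒ (l<k , c′<t , inj₁ c<c′)          = l<k , c′<t , inj₁ c<c′
  PendingAt-suc⇒ (l<k , c′<t , inj₂ (c≡c′ , λ′<l)) = l<k , c′<t , inj₂ (c≡c′ , <⇒≤ λ′<l)

  Pending-suc⇒ : ∀ c λ′ x → Pending c (suc λ′) x → Pending c λ′ x
  Pending-suc⇒ c λ′ (vtx a)     a<n = a<n
  Pending-suc⇒ c λ′ (pvtx c′ l) pending = PendingAt-suc⇒ pending
  Pending-suc⇒ c λ′ (qvtx c′ l) pending = PendingAt-suc⇒ pending

  PendingAt-nextStage⇒ : ∀ {c λ′ c′ l} → PendingAt (suc c) 0 c′ l → PendingAt c λ′ c′ l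
  PendingAt-nextStage⇒ (l<k , c′<t , inj₁ c<c′)       = l<k , c′<t , inj₁ (<⇒≤ c<c′)
  PendingAt-nextStage⇒ (l<k , c′<t , inj₂ (refl , _)) = l<k , c′<t , inj₁ ≤-refl

  Pending-nextStage⇒ : ∀ c λ′ x → Pending (suc c) 0 x → Pending c λ′ x
  Pending-nextStage⇒ c λ′ (vtx a)     a<n = a<n
  Pending-nextStage⇒ c λ′ (pvtx c′ l) pending = PendingAt-nextStage⇒ pending
  Pending-nextStage⇒ c λ′ (qvtx c′ l) pending = PendingAt-nextStage⇒ pending

  double+ : ℕ → ℕ → ℕ
  double+ zero    m = m
  double+ (suc e) m = 2 + double+ e m

  withPairs : (c λ′ e : ℕ) {m : ℕ} → (Fin m → Node) → Fin (double+ e m) → Node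
  withPairs c λ′ zero    f x             = f x
  withPairs c λ′ (suc e) f zero          = pvtx c λ′
  withPairs c λ′ (suc e) f (suc zero)    = qvtx c λ′
  withPairs c λ′ (suc e) f (suc (suc x)) = withPairs c (suc λ′) e f x

  hostSize : ℕ → ℕ
  hostSize zero    = n
  hostSize (suc s) = double+ k (hostSize s)

  -- the pairs of the stages c, …, c + s - 1, then G's vertices: every pivot is on the first two vertices
  hostNodes : (s c : ℕ) → Fin (hostSize s) → Node
  hostNodes zero    c x = vtx (toℕ x)
  hostNodes (suc s) c   = withPairs c 0 k (hostNodes s (suc c))

  hostSize≡ : ∀ s → hostSize s ≡ s * (k + k) + n
  hostSize≡ zero    = refl
  hostSize≡ (suc s) = trans (double+≡ k (hostSize s)) (trans (cong ((k + k) +_) (hostSize≡ s)) (sym (+-assoc (k + k) _ n)))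
    where
    double+≡ : ∀ e m → double+ e m ≡ (e + e) + m
    double+≡ zero    m = refl
    double+≡ (suc e) m = cong suc (trans (cong suc (double+≡ e m)) (cong (_+ m) (sym (+-suc e e))))

  withPairs-pending : ∀ c λ′ e {m} (f : Fin m → Node) → λ′ + e ≡ k → c < t →
    (∀ x → Pending (suc c) 0 (f x)) → ∀ x → Pending c λ′ (withPairs c λ′ e f x)
  withPairs-pending c λ′ zero    f _   _   f-pending x = Pending-nextStage⇒ c λ′ (f x) (f-pending x)
  withPairs-pending c λ′ (suc e) f λ′+e c<t f-pending zero       = +suc≡⇒< λ′+e , c<t , inj₂ (refl , ≤-refl)
  withPairs-pending c λ′ (suc e) f λ′+e c<t f-pending (suc zero) = +suc≡⇒< λ′+e , c<t , inj₂ (refl , ≤-refl)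
  withPairs-pending c λ′ (suc e) f λ′+e c<t f-pending (suc (suc x)) =
    Pending-suc⇒ c λ′ _ (withPairs-pending c (suc λ′) e f (trans (sym (+-suc λ′ e)) λ′+e) c<t f-pending x)

  hostNodes-pending : ∀ s c → s + c ≡ t → ∀ x → Pending c 0 (hostNodes s c x)
  hostNodes-pending zero    c _   x = toℕ<n x
  hostNodes-pending (suc s) c s+c =
    withPairs-pending c 0 k (hostNodes s (suc c)) refl c<t (hostNodes-pending s (suc c) (trans (+-suc s c) s+c))
    where
    c<t : c < t
    c<t = subst (c <_) s+c (s≤s (m≤n+m c s))

  PendingAt-irrefl : ∀ {c λ′} → PendingAt c (suc λ′) c λ′ → ⊥
  PendingAt-irrefl (_ , _ , inj₁ c<c)        = <-irrefl refl c<c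
  PendingAt-irrefl (_ , _ , inj₂ (_ , λ′<λ′)) = <-irrefl refl λ′<λ′

  -- the pairs still to come are pending, so they differ from the pair in front
  withPairs-injective : ∀ c λ′ e {m} (f : Fin m → Node) → λ′ + e ≡ k → c < t → (∀ x → Pending (suc c) 0 (f x)) →
    Injective _≡_ _≡_ f → Injective _≡_ _≡_ (withPairs c λ′ e f)
  withPairs-injective c λ′ zero    f _ _ _ f-inj = f-inj
  withPairs-injective c λ′ (suc e) f λ′+e+1≡k c<t f-pending f-inj {x} {y} = go x y
    where
    λ′+1+e≡k = trans (sym (+-suc λ′ e)) λ′+e+1≡k
    pending = withPairs-pending c (suc λ′) e f λ′+1+e≡k c<t f-pending
    rest-inj = withPairs-injective c (suc λ′) e f λ′+1+e≡k c<t f-pending f-inj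
    go : ∀ x y → withPairs c λ′ (suc e) f x ≡ withPairs c λ′ (suc e) f y → x ≡ y
    go zero          zero          _  = refl
    go (suc zero)    (suc zero)    _  = refl
    go (suc (suc x)) (suc (suc y)) eq = cong (λ z → suc (suc z)) (rest-inj eq)
    go zero          (suc zero)    ()
    go (suc zero)    zero          ()
    go zero          (suc (suc y)) eq = ⊥-elim (PendingAt-irrefl (subst (Pending c (suc λ′)) (sym eq) (pending y)))
    go (suc zero)    (suc (suc y)) eq = ⊥-elim (PendingAt-irrefl (subst (Pending c (suc λ′)) (sym eq) (pending y)))
    go (suc (suc x)) zero          eq = ⊥-elim (PendingAt-irrefl (subst (Pending c (suc λ′)) eq (pending x)))
    go (suc (suc x)) (suc zero)    eq = ⊥-elim (PendingAt-irrefl (subst (Pending c (suc λ′)) eq (pending x)))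

  hostNodes-injective : ∀ s c → s + c ≡ t → Injective _≡_ _≡_ (hostNodes s c)
  hostNodes-injective zero    c _   eq = toℕ-injective (vtx-injective eq)
    where
    vtx-injective : ∀ {a b} → vtx a ≡ vtx b → a ≡ b
    vtx-injective refl = refl
  hostNodes-injective (suc s) c s+1+c≡t =
    withPairs-injective c 0 k (hostNodes s (suc c)) refl c<t (hostNodes-pending s (suc c) s+c+1≡t)
      (hostNodes-injective s (suc c) s+c+1≡t)
    where
    s+c+1≡t = trans (+-suc s c) s+1+c≡t
    c<t : c < t
    c<t = subst (c <_) s+1+c≡t (s≤s (m≤n+m c s))

module Construction (t k : ℕ) (A : ℕ → ℕ → Bool) (A-sym : ∀ a b → A a b ≡ A b a) (A-loop : ∀ a → A a a ≡ false)
                    (S : CutSequence (3 + t) k A) where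
  open CutSequence S
  open Layout t k public

  -- the right-hand vertices seen by the q-vertices of stage c
  frontier : ℕ → ℕ → Bool
  frontier c a = (a ≡ᵇ 2 + c) ∨ ((suc c ≡ᵇ t) ∧ (a ≡ᵇ 2 + t))

  keptEdge : ℕ → ℕ → Bool
  keptEdge a b = isPair a b 0 1 ∨ isPair a b (1 + t) (2 + t)

  hostVV : ℕ → ℕ → Bool
  hostVV a b = keptEdge a b ∧ A a b

  -- p c j sees the vertex c + 1 entering the left side at stage c, and also the vertex 0 at stage 0
  hostVP : ℕ → ℕ → ℕ → Bool
  hostVP a c j = ((suc a ≡ᵇ 2 + c) ∨ ((c ≡ᵇ 0) ∧ (a ≡ᵇ 0))) ∧ coeff c a j

  hostVQ : ℕ → ℕ → ℕ → Bool
  hostVQ a c l = frontier c a ∧ basisRow c l a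

  hostPQ : ℕ → ℕ → ℕ → ℕ → Bool
  hostPQ c j c′ l = ((c ≡ᵇ c′) ∧ (j ≡ᵇ l)) ∨ ((c ≡ᵇ suc c′) ∧ transition c′ j l)

  host : Node → Node → Bool
  host (vtx a)    (vtx b)     = hostVV a b
  host (vtx a)    (pvtx c j)  = hostVP a c j
  host (pvtx c j) (vtx a)     = hostVP a c j
  host (vtx a)    (qvtx c l)  = hostVQ a c l
  host (qvtx c l) (vtx a)     = hostVQ a c l
  host (pvtx c j) (qvtx c′ l) = hostPQ c j c′ l
  host (qvtx c′ l) (pvtx c j) = hostPQ c j c′ l
  host (pvtx _ _) (pvtx _ _)  = false
  host (qvtx _ _) (qvtx _ _)  = false

  -- the graph after pivoting all pairs of the stages < c and the first λ pairs of stage c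
  stageVV : ℕ → ℕ → ℕ → ℕ → Bool
  stageVV c λ′ a b =
    if (a <ᵇ 2 + c) ∧ (b <ᵇ 2 + c) then A a b
    else if (a <ᵇ 2 + c) ∧ frontier c b then xorBelow λ′ (λ l → coeff c a l ∧ basisRow c l b)
    else if (b <ᵇ 2 + c) ∧ frontier c a then xorBelow λ′ (λ l → coeff c b l ∧ basisRow c l a)
    else hostVV a b

  stageVP : ℕ → ℕ → ℕ → ℕ → ℕ → Bool
  stageVP c λ′ a c′ j =
    if c′ ≡ᵇ c then (a <ᵇ 2 + c) ∧ coeff c a j
    else if c′ ≡ᵇ suc c then
      (if a <ᵇ 2 + c then xorBelow λ′ (λ l → transition c j l ∧ coeff c a l) else hostVP a c′ j)
    else hostVP a c′ j

  stage : ℕ → ℕ → Node → Node → Bool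
  stage c λ′ (vtx a)     (vtx b)     = stageVV c λ′ a b
  stage c λ′ (vtx a)     (pvtx c′ j) = stageVP c λ′ a c′ j
  stage c λ′ (pvtx c′ j) (vtx a)     = stageVP c λ′ a c′ j
  stage c λ′ x y = host x y

  frontier⇒≮ : ∀ c a → frontier c a ≡ true → (a <ᵇ 2 + c) ≡ false
  frontier⇒≮ c a fr with a ≡ᵇ 2 + c in a≡c+2
  ... | true = subst (λ a → (a <ᵇ 2 + c) ≡ false) (sym (≡ᵇ-true⇒≡ a (2 + c) a≡c+2)) (<ᵇ-false (≤-refl {2 + c}))
  ... | false with suc c ≡ᵇ t in c+1≡t | a ≡ᵇ 2 + t in a≡t+2
  ...   | true | true = subst (λ a → (a <ᵇ 2 + c) ≡ false) a≡c+3 (<ᵇ-false (n≤1+n (2 + c)))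
    where
    a≡c+3 : 3 + c ≡ a
    a≡c+3 = sym (trans (≡ᵇ-true⇒≡ a (2 + t) a≡t+2) (cong (2 +_) (sym (≡ᵇ-true⇒≡ (suc c) t c+1≡t))))

  hostVV-sym : ∀ a b → hostVV a b ≡ hostVV b a
  hostVV-sym a b rewrite isPair-sym a b 0 1 | isPair-sym a b (1 + t) (2 + t) | A-sym a b = refl

  stageVV-sym : ∀ c λ′ a b → stageVV c λ′ a b ≡ stageVV c λ′ b a
  stageVV-sym c λ′ a b with a <ᵇ 2 + c in a<c+2 | b <ᵇ 2 + c in b<c+2 | frontier c a in fr-a | frontier c b in fr-b
  ... | true  | true  | _     | _     = A-sym a b
  ... | true  | false | true  | _     = contradiction (trans (sym a<c+2) (frontier⇒≮ c a fr-a)) λ ()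
  ... | true  | false | false | true  = refl
  ... | true  | false | false | false = hostVV-sym a b
  ... | false | true  | _     | true  = contradiction (trans (sym b<c+2) (frontier⇒≮ c b fr-b)) λ ()
  ... | false | true  | true  | false = refl
  ... | false | true  | false | false = hostVV-sym a b
  ... | false | false | _     | _     = hostVV-sym a b

  stage-sym : ∀ c λ′ x y → stage c λ′ x y ≡ stage c λ′ y x
  stage-sym c λ′ (vtx a)    (vtx b)    = stageVV-sym c λ′ a b
  stage-sym c λ′ (vtx _)    (pvtx _ _) = refl
  stage-sym c λ′ (vtx _)    (qvtx _ _) = refl
  stage-sym c λ′ (pvtx _ _) (vtx _)    = refl
  stage-sym c λ′ (pvtx _ _) (pvtx _ _) = refl
  stage-sym c λ′ (pvtx _ _) (qvtx _ _) = refl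
  stage-sym c λ′ (qvtx _ _) (vtx _)    = refl
  stage-sym c λ′ (qvtx _ _) (pvtx _ _) = refl
  stage-sym c λ′ (qvtx _ _) (qvtx _ _) = refl

  stage-loop : ∀ c λ′ x → stage c λ′ x x ≡ false
  stage-loop c λ′ (vtx a) with a <ᵇ 2 + c in a<c+2 | frontier c a in fr-a
  ... | true  | true  = contradiction (trans (sym a<c+2) (frontier⇒≮ c a fr-a)) λ ()
  ... | true  | false = A-loop a
  ... | false | _     = trans (cong (keptEdge a a ∧_) (A-loop a)) (∧-zeroʳ _)
  stage-loop c λ′ (pvtx _ _) = refl
  stage-loop c λ′ (qvtx _ _) = refl

  pivotRule-sym : ∀ (R : Node → Node → Bool) P Q → (∀ x y → R x y ≡ R y x) →
    ∀ x y → pivotRule R P Q x y ≡ pivotRule R P Q y x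
  pivotRule-sym R P Q R-sym x y
    rewrite R-sym x y | ∧-comm (R x P) (R y Q) | ∧-comm (R x Q) (R y P) =
    cong (R y x xor_) (xor-comm (R y Q ∧ R x P) (R y P ∧ R x Q))

  hostPQ-pending : ∀ c λ′ c′ l → PendingAt c (suc λ′) c′ l → hostPQ c λ′ c′ l ≡ false
  hostPQ-pending c λ′ c′ l (_ , _ , inj₁ c<c′)
    rewrite ≢⇒≡ᵇ-false (<⇒≢ c<c′) | ≢⇒≡ᵇ-false {c} {suc c′} (<⇒≢ (<-trans c<c′ (n<1+n c′))) = refl
  hostPQ-pending c λ′ .c l (_ , _ , inj₂ (refl , λ′<l))
    rewrite ≢⇒≡ᵇ-false (<⇒≢ λ′<l) | ≢⇒≡ᵇ-false {c} {suc c} (<⇒≢ (n<1+n c)) | ∧-zeroʳ (c ≡ᵇ c) = refl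

  stage-pivotEdge : ∀ c λ′ → stage c λ′ (pvtx c λ′) (qvtx c λ′) ≡ true
  stage-pivotEdge c λ′ rewrite ≡ᵇ-refl c | ≡ᵇ-refl λ′ = refl

  stage-pivotVV : ∀ c λ′ a b →
    pivotRule (stage c λ′) (pvtx c λ′) (qvtx c λ′) (vtx a) (vtx b) ≡ stage c (suc λ′) (vtx a) (vtx b)
  stage-pivotVV c λ′ a b rewrite ≡ᵇ-refl c
    with a <ᵇ 2 + c in a<c+2 | b <ᵇ 2 + c in b<c+2 | frontier c a in fr-a | frontier c b in fr-b
  ... | true  | _     | true  | _     = contradiction (trans (sym a<c+2) (frontier⇒≮ c a fr-a)) λ ()
  ... | _     | true  | _     | true  = contradiction (trans (sym b<c+2) (frontier⇒≮ c b fr-b)) λ ()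
  ... | true  | true  | false | false = xor-≡false _ (xor-≡false-both (coeff c a λ′) false)
  ... | true  | false | false | true  = cong (xorBelow λ′ (λ l → coeff c a l ∧ basisRow c l b) xor_) (xor-identityʳ _)
  ... | true  | false | false | false = xor-≡false _ (xor-≡false-both (coeff c a λ′) false)
  ... | false | true  | true  | false =
    cong (xorBelow λ′ (λ l → coeff c b l ∧ basisRow c l a) xor_) (∧-comm (basisRow c λ′ a) (coeff c b λ′))
  ... | false | true  | false | false = xor-identityʳ _
  ... | false | false | false | _     = xor-≡false _ (∧-zeroʳ (false ∧ basisRow c λ′ a))
  ... | false | false | true  | _     = xor-≡false _ (∧-zeroʳ (true ∧ basisRow c λ′ a))

  stage-pivotVP : ∀ c λ′ a c′ j → PendingAt c (suc λ′) c′ j →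
    pivotRule (stage c λ′) (pvtx c λ′) (qvtx c λ′) (vtx a) (pvtx c′ j) ≡ stage c (suc λ′) (vtx a) (pvtx c′ j)
  stage-pivotVP c λ′ a .c j (_ , _ , inj₂ (refl , λ′<j))
    rewrite ≡ᵇ-refl c | ≢⇒≡ᵇ-false (<⇒≢ λ′<j ∘ sym) | ≢⇒≡ᵇ-false {c} {suc c} (<⇒≢ (n<1+n c)) =
    xor-≡false _ (xor-≡false-both ((a <ᵇ 2 + c) ∧ coeff c a λ′) (hostVQ a c λ′))
  stage-pivotVP c λ′ a c′ j (_ , _ , inj₁ c<c′) rewrite ≡ᵇ-refl c | ≢⇒≡ᵇ-false (<⇒≢ c<c′ ∘ sym)
    with c′ ≡ᵇ suc c in c′≡c+1
  ... | false = xor-≡false _ (xor-≡false-both ((a <ᵇ 2 + c) ∧ coeff c a λ′) (hostVQ a c λ′))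
  ... | true with ≡ᵇ-true⇒≡ c′ (suc c) c′≡c+1
  ...   | refl rewrite ≡ᵇ-refl c with a <ᵇ 2 + c
  ...     | true  = cong (xorBelow λ′ (λ l → transition c j l ∧ coeff c a l) xor_)
                      (trans (xor-≡false _ (∧-zeroʳ (hostVQ a c λ′))) (∧-comm (coeff c a λ′) (transition c j λ′)))
  ...     | false = xor-≡false _ (∧-zeroʳ (hostVQ a c λ′))

  stage-pivot : ∀ c λ′ x y → Pending c (suc λ′) x → Pending c (suc λ′) y →
    pivotRule (stage c λ′) (pvtx c λ′) (qvtx c λ′) x y ≡ stage c (suc λ′) x y
  stage-pivot c λ′ (vtx a)     (vtx b)     _ _ = stage-pivotVV c λ′ a b
  stage-pivot c λ′ (vtx a)     (pvtx c′ j) _ pending = stage-pivotVP c λ′ a c′ j pending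
  stage-pivot c λ′ (pvtx c′ j) (vtx a)     pending _ =
    trans (pivotRule-sym (stage c λ′) (pvtx c λ′) (qvtx c λ′) (stage-sym c λ′) (pvtx c′ j) (vtx a))
          (stage-pivotVP c λ′ a c′ j pending)
  stage-pivot c λ′ (vtx a)     (qvtx c′ l) _ pending rewrite hostPQ-pending c λ′ c′ l pending =
    xor-≡false _ (xor-≡false-both (stage c λ′ (vtx a) (pvtx c λ′)) (hostVQ a c λ′))
  stage-pivot c λ′ (qvtx c′ l) (vtx a)     pending _ rewrite hostPQ-pending c λ′ c′ l pending = xor-identityʳ _
  stage-pivot c λ′ (pvtx c₁ j₁) (pvtx c₂ j₂) _ _ rewrite ∧-zeroʳ (hostPQ c₁ j₁ c λ′) = refl
  stage-pivot c λ′ (pvtx c₁ j₁) (qvtx c₂ l) _ pending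
    rewrite hostPQ-pending c λ′ c₂ l pending | ∧-zeroʳ (hostPQ c₁ j₁ c λ′) = xor-identityʳ _
  stage-pivot c λ′ (qvtx c₂ l) (pvtx c₁ j₁) pending _ rewrite hostPQ-pending c λ′ c₂ l pending = xor-identityʳ _
  stage-pivot c λ′ (qvtx c₁ l₁) (qvtx c₂ l₂) pending _ rewrite hostPQ-pending c λ′ c₁ l₁ pending = xor-identityʳ _

  frontier-inner : ∀ c a → suc c < t → frontier c a ≡ (a ≡ᵇ 2 + c)
  frontier-inner c a c+1<t rewrite ≢⇒≡ᵇ-false (<⇒≢ c+1<t) = ∨-identityʳ _

  keptEdge-false : ∀ a b → a < 1 + t → 2 ≤ b → keptEdge a b ≡ false
  keptEdge-false a b a≤t 2≤b
    rewrite ≢⇒≡ᵇ-false {b} {1} (<⇒≢ 2≤b ∘ sym) | ≢⇒≡ᵇ-false {b} {0} (<⇒≢ (<-trans (s≤s z≤n) 2≤b) ∘ sym)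
          | ≢⇒≡ᵇ-false (<⇒≢ a≤t) | ≢⇒≡ᵇ-false (<⇒≢ (<-trans a≤t (n<1+n (1 + t))))
          | ∧-zeroʳ (a ≡ᵇ 0) | ∧-zeroʳ (a ≡ᵇ 1) = refl

  keptEdge-false′ : ∀ a b → 2 ≤ a → b < 1 + t → keptEdge a b ≡ false
  keptEdge-false′ a b 2≤a b≤t =
    trans (cong₂ _∨_ (isPair-sym a b 0 1) (isPair-sym a b (1 + t) (2 + t))) (keptEdge-false b a b≤t 2≤a)

  hostVV-false : ∀ a b → keptEdge a b ≡ false → hostVV a b ≡ false
  hostVV-false a b e rewrite e = refl

  stage-completeVV : ∀ c → suc c < t → ∀ a b → a < n → b < n → stageVV c k a b ≡ stageVV (suc c) 0 a b
  stage-completeVV c c+1<t a b a<n b<n rewrite frontier-inner c a c+1<t | frontier-inner c b c+1<t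
    with <-cmp a (2 + c) | <-cmp b (2 + c)
  ... | tri< a<c+2 _ _ | tri< b<c+2 _ _
    rewrite <ᵇ-true a<c+2 | <ᵇ-true b<c+2 | <ᵇ-true (m≤n⇒m≤1+n a<c+2) | <ᵇ-true (m≤n⇒m≤1+n b<c+2) = refl
  ... | tri< a<c+2 _ _ | tri≈ _ refl _
    rewrite <ᵇ-true a<c+2 | <ᵇ-false (≤-refl {2 + c}) | ≡ᵇ-refl (2 + c) | <ᵇ-true (m≤n⇒m≤1+n a<c+2)
          | <ᵇ-true (n<1+n (2 + c)) = sym (spans c a (2 + c) a<c+2 ≤-refl b<n)
  ... | tri< a<c+2 _ _ | tri> _ _ b>c+2
    rewrite <ᵇ-true a<c+2 | <ᵇ-false (<⇒≤ b>c+2) | ≢⇒≡ᵇ-false (<⇒≢ b>c+2 ∘ sym) | <ᵇ-true (m≤n⇒m≤1+n a<c+2)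
          | <ᵇ-false b>c+2 with frontier (suc c) b
  ...   | true  = hostVV-false a b
                    (keptEdge-false a b (m≤n⇒m≤1+n (<-≤-trans a<c+2 c+1<t)) (≤-trans (s≤s (s≤s z≤n)) (<⇒≤ b>c+2)))
  ...   | false = refl
  stage-completeVV c c+1<t a b a<n b<n | tri≈ _ refl _ | tri< b<c+2 _ _
    rewrite <ᵇ-true b<c+2 | <ᵇ-false (≤-refl {2 + c}) | ≡ᵇ-refl (2 + c) | <ᵇ-true (m≤n⇒m≤1+n b<c+2)
          | <ᵇ-true (n<1+n (2 + c)) = trans (sym (spans c b (2 + c) b<c+2 ≤-refl a<n)) (A-sym b a)
  stage-completeVV c c+1<t a b a<n b<n | tri≈ _ refl _ | tri≈ _ refl _
    rewrite <ᵇ-false (≤-refl {2 + c}) | <ᵇ-true (n<1+n (2 + c)) | A-loop (2 + c) = ∧-zeroʳ _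
  stage-completeVV c c+1<t a b a<n b<n | tri≈ _ refl _ | tri> _ _ b>c+2
    rewrite <ᵇ-false (≤-refl {2 + c}) | <ᵇ-false (<⇒≤ b>c+2) | <ᵇ-true (n<1+n (2 + c))
          | <ᵇ-false b>c+2 with frontier (suc c) b
  ...   | true  = hostVV-false a b (keptEdge-false a b (s≤s c+1<t) (≤-trans (s≤s (s≤s z≤n)) (<⇒≤ b>c+2)))
  ...   | false = refl
  stage-completeVV c c+1<t a b a<n b<n | tri> _ _ a>c+2 | tri< b<c+2 _ _
    rewrite <ᵇ-true b<c+2 | <ᵇ-false (<⇒≤ a>c+2) | ≢⇒≡ᵇ-false (<⇒≢ a>c+2 ∘ sym) | <ᵇ-true (m≤n⇒m≤1+n b<c+2)
          | <ᵇ-false a>c+2 with frontier (suc c) a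
  ...   | true  = hostVV-false a b
                    (keptEdge-false′ a b (≤-trans (s≤s (s≤s z≤n)) (<⇒≤ a>c+2)) (m≤n⇒m≤1+n (<-≤-trans b<c+2 c+1<t)))
  ...   | false = refl
  stage-completeVV c c+1<t a b a<n b<n | tri> _ _ a>c+2 | tri≈ _ refl _
    rewrite <ᵇ-false (≤-refl {2 + c}) | <ᵇ-false (<⇒≤ a>c+2) | <ᵇ-true (n<1+n (2 + c))
          | <ᵇ-false a>c+2 with frontier (suc c) a
  ...   | true  = hostVV-false a b (keptEdge-false′ a b (≤-trans (s≤s (s≤s z≤n)) (<⇒≤ a>c+2)) (s≤s c+1<t))
  ...   | false = refl
  stage-completeVV c c+1<t a b a<n b<n | tri> _ _ a>c+2 | tri> _ _ b>c+2
    rewrite <ᵇ-false (<⇒≤ a>c+2) | <ᵇ-false (<⇒≤ b>c+2)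
          | <ᵇ-false a>c+2 | <ᵇ-false b>c+2 = refl

  stage-completeVP : ∀ c → suc c < t → ∀ a c′ j → suc c ≤ c′ → stageVP c k a c′ j ≡ stageVP (suc c) 0 a c′ j
  stage-completeVP c c+1<t a c′ j c<c′ with <-cmp c′ (suc c)
  ... | tri< c′<c+1 _ _ = contradiction (<-≤-trans c′<c+1 c<c′) (<-irrefl refl)
  ... | tri≈ _ refl _ rewrite ≢⇒≡ᵇ-false {suc c} {c} (<⇒≢ (n<1+n c) ∘ sym) | ≡ᵇ-refl c with <-cmp a (2 + c)
  ...   | tri< a<c+2 _ _ rewrite <ᵇ-true a<c+2 | <ᵇ-true (m≤n⇒m≤1+n a<c+2) = sym (coeff-suc c a j a<c+2)
  ...   | tri≈ _ refl _  rewrite <ᵇ-false (≤-refl {2 + c}) | <ᵇ-true (n<1+n (2 + c)) | ≡ᵇ-refl (2 + c) = refl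
  ...   | tri> _ _ a>c+2 rewrite <ᵇ-false (<⇒≤ a>c+2) | <ᵇ-false a>c+2
                               | ≢⇒≡ᵇ-false {suc a} {3 + c} (<⇒≢ a>c+2 ∘ sym ∘ cong pred) = refl
  stage-completeVP c c+1<t a c′ j c<c′ | tri> _ _ c′>c+1
    rewrite ≢⇒≡ᵇ-false {c′} {c} (<⇒≢ (<-trans (n<1+n c) c′>c+1) ∘ sym) | ≢⇒≡ᵇ-false (<⇒≢ c′>c+1 ∘ sym)
    with <-cmp c′ (2 + c)
  ... | tri< c′<c+2 _ _ = contradiction (<-≤-trans c′<c+2 c′>c+1) (<-irrefl refl)
  ... | tri≈ _ refl _ rewrite ≡ᵇ-refl (suc c) with <-cmp a (3 + c)
  ...   | tri< a<c+3 _ _ rewrite <ᵇ-true a<c+3 | ≢⇒≡ᵇ-false {suc a} {4 + c} (<⇒≢ a<c+3 ∘ cong pred) = refl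
  ...   | tri≈ _ refl _  rewrite <ᵇ-false (≤-refl {3 + c}) = refl
  ...   | tri> _ _ a>c+3 rewrite <ᵇ-false (<⇒≤ a>c+3) = refl
  stage-completeVP c c+1<t a c′ j c<c′ | tri> _ _ c′>c+1 | tri> _ _ c′>c+2 rewrite ≢⇒≡ᵇ-false (<⇒≢ c′>c+2 ∘ sym) = refl

  stage-complete : ∀ c → suc c < t → ∀ x y → Pending (suc c) 0 x → Pending (suc c) 0 y → stage c k x y ≡ stage (suc c) 0 x y
  stage-complete c c+1<t (vtx a)     (vtx b)     a<n b<n = stage-completeVV c c+1<t a b a<n b<n
  stage-complete c c+1<t (vtx a)     (pvtx c′ j) _ (_ , _ , inj₁ c<c′)       = stage-completeVP c c+1<t a c′ j (<⇒≤ c<c′)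
  stage-complete c c+1<t (vtx a)     (pvtx c′ j) _ (_ , _ , inj₂ (refl , _)) = stage-completeVP c c+1<t a c′ j ≤-refl
  stage-complete c c+1<t (pvtx c′ j) (vtx a)     (_ , _ , inj₁ c<c′) _       = stage-completeVP c c+1<t a c′ j (<⇒≤ c<c′)
  stage-complete c c+1<t (pvtx c′ j) (vtx a)     (_ , _ , inj₂ (refl , _)) _ = stage-completeVP c c+1<t a c′ j ≤-refl
  stage-complete c c+1<t (vtx _)     (qvtx _ _)  _ _ = refl
  stage-complete c c+1<t (pvtx _ _)  (pvtx _ _)  _ _ = refl
  stage-complete c c+1<t (pvtx _ _)  (qvtx _ _)  _ _ = refl
  stage-complete c c+1<t (qvtx _ _)  (vtx _)     _ _ = refl
  stage-complete c c+1<t (qvtx _ _)  (pvtx _ _)  _ _ = refl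
  stage-complete c c+1<t (qvtx _ _)  (qvtx _ _)  _ _ = refl

  host≡stage₀VV : 1 ≤ t → ∀ a b → hostVV a b ≡ stageVV 0 0 a b
  host≡stage₀VV 1≤t 0 0 = trans (cong (keptEdge 0 0 ∧_) (A-loop 0)) (trans (∧-zeroʳ (keptEdge 0 0)) (sym (A-loop 0)))
  host≡stage₀VV 1≤t 0 1 = refl
  host≡stage₀VV 1≤t 1 0 = refl
  host≡stage₀VV 1≤t 1 1 = trans (cong (keptEdge 1 1 ∧_) (A-loop 1)) (trans (∧-zeroʳ (keptEdge 1 1)) (sym (A-loop 1)))
  host≡stage₀VV 1≤t a (suc (suc b)) with a <ᵇ 2 in a<2
  ... | true with frontier 0 (2 + b)
  ...   | true  = hostVV-false a (2 + b) (keptEdge-false a (2 + b) (<-≤-trans (<ᵇ-true⇒< a 2 a<2) (s≤s 1≤t)) (s≤s (s≤s z≤n)))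
  ...   | false = refl
  host≡stage₀VV 1≤t a (suc (suc b)) | false = refl
  host≡stage₀VV 1≤t (suc (suc a)) 0 with frontier 0 (2 + a)
  ... | true  = hostVV-false (2 + a) 0 (keptEdge-false′ (2 + a) 0 (s≤s (s≤s z≤n)) (s≤s z≤n))
  ... | false = refl
  host≡stage₀VV 1≤t (suc (suc a)) 1 with frontier 0 (2 + a)
  ... | true  = hostVV-false (2 + a) 1 (keptEdge-false′ (2 + a) 1 (s≤s (s≤s z≤n)) (s≤s 1≤t))
  ... | false = refl

  host≡stage₀VP : ∀ a c′ j → hostVP a c′ j ≡ stageVP 0 0 a c′ j
  host≡stage₀VP 0             0             j = refl
  host≡stage₀VP 1             0             j = refl
  host≡stage₀VP (suc (suc a)) 0             j = refl
  host≡stage₀VP 0             1             j = refl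
  host≡stage₀VP 1             1             j = refl
  host≡stage₀VP (suc (suc a)) 1             j = refl
  host≡stage₀VP a             (suc (suc c′)) j = refl

  host≡stage₀ : 1 ≤ t → ∀ x y → host x y ≡ stage 0 0 x y
  host≡stage₀ 1≤t (vtx a)     (vtx b)     = host≡stage₀VV 1≤t a b
  host≡stage₀ 1≤t (vtx a)     (pvtx c′ j) = host≡stage₀VP a c′ j
  host≡stage₀ 1≤t (pvtx c′ j) (vtx a)     = host≡stage₀VP a c′ j
  host≡stage₀ 1≤t (vtx _)     (qvtx _ _)  = refl
  host≡stage₀ 1≤t (pvtx _ _)  (pvtx _ _)  = refl
  host≡stage₀ 1≤t (pvtx _ _)  (qvtx _ _)  = refl
  host≡stage₀ 1≤t (qvtx _ _)  (vtx _)     = refl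
  host≡stage₀ 1≤t (qvtx _ _)  (pvtx _ _)  = refl
  host≡stage₀ 1≤t (qvtx _ _)  (qvtx _ _)  = refl

  rightEnd : ∀ b → 1 + t ≤ b → b < n → b ≡ 1 + t ⊎ b ≡ 2 + t
  rightEnd b t+1≤b b<n with <-cmp b (1 + t)
  ... | tri< b<t+1 _ _ = contradiction (<-≤-trans b<t+1 t+1≤b) (<-irrefl refl)
  ... | tri≈ _ b≡t+1 _ = inj₁ b≡t+1
  ... | tri> _ _ b>t+1 = inj₂ (≤-antisym (≤-pred b<n) b>t+1)

  frontier-last : ∀ c → suc c ≡ t → ∀ b → 1 + t ≤ b → b < n → frontier c b ≡ true
  frontier-last c c+1≡t b t+1≤b b<n with rightEnd b t+1≤b b<n
  ... | inj₁ refl rewrite sym c+1≡t | ≡ᵇ-refl c = refl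
  ... | inj₂ refl rewrite sym c+1≡t | ≡ᵇ-refl c = ∨-zeroʳ _

  keptEdge-last : keptEdge (1 + t) (2 + t) ≡ true
  keptEdge-last = trans (cong (isPair (1 + t) (2 + t) 0 1 ∨_) (isPair-refl (1 + t) (2 + t))) (∨-zeroʳ _)

  hostVV-last : ∀ a b → 1 + t ≤ a → 1 + t ≤ b → a < n → b < n → hostVV a b ≡ A a b
  hostVV-last a b t+1≤a t+1≤b a<n b<n with rightEnd a t+1≤a a<n | rightEnd b t+1≤b b<n
  ... | inj₁ refl | inj₁ refl rewrite A-loop (1 + t) = ∧-zeroʳ _
  ... | inj₁ refl | inj₂ refl = cong (_∧ A (1 + t) (2 + t)) keptEdge-last
  ... | inj₂ refl | inj₁ refl = trans (hostVV-sym (2 + t) (1 + t))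
                                  (trans (cong (_∧ A (1 + t) (2 + t)) keptEdge-last) (A-sym (1 + t) (2 + t)))
  ... | inj₂ refl | inj₂ refl rewrite A-loop (2 + t) = ∧-zeroʳ _

  last-rightSide : ∀ c → suc c ≡ t → ∀ x → (x <ᵇ 2 + c) ≡ false → 1 + t ≤ x
  last-rightSide c c+1≡t x x≮c+2 = subst (_≤ x) (cong suc c+1≡t) (<ᵇ-false⇒≥ x (2 + c) x≮c+2)

  stage-last : ∀ c → suc c ≡ t → ∀ a b → a < n → b < n → stageVV c k a b ≡ A a b
  stage-last c c+1≡t a b a<n b<n with a <ᵇ 2 + c in a<c+2 | b <ᵇ 2 + c in b<c+2
  ... | true | true = refl
  ... | true | false rewrite frontier-last c c+1≡t b (last-rightSide c c+1≡t b b<c+2) b<n =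
    sym (spans c a b (<ᵇ-true⇒< a (2 + c) a<c+2) (<ᵇ-false⇒≥ b (2 + c) b<c+2) b<n)
  ... | false | true rewrite frontier-last c c+1≡t a (last-rightSide c c+1≡t a a<c+2) a<n =
    trans (sym (spans c b a (<ᵇ-true⇒< b (2 + c) b<c+2) (<ᵇ-false⇒≥ a (2 + c) a<c+2) a<n)) (A-sym b a)
  ... | false | false = hostVV-last a b (last-rightSide c c+1≡t a a<c+2) (last-rightSide c c+1≡t b b<c+2) a<n b<n

  stage-simple : ∀ {m} c λ′ (f : Fin m → Node) → IsSimple (stage c λ′ on f)
  stage-simple c λ′ f = (λ x y → stage-sym c λ′ (f x) (f y)) , (λ x → stage-loop c λ′ (f x))

  pivot-pairs : ∀ c e λ′ {m} (f : Fin m → Node) → λ′ + e ≡ k → c < t → (∀ x → Pending (suc c) 0 (f x)) →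
    HasPivotMinor (stage c λ′ on withPairs c λ′ e f) (stage c k on f)
  pivot-pairs c zero λ′ f λ′+0≡k _ _ rewrite trans (sym (+-identityʳ λ′)) λ′+0≡k = HasPivotMinor-≗ᴳ (λ _ _ → refl)
  pivot-pairs c (suc e) λ′ f λ′+e+1≡k c<t f-pending =
    HasPivotMinor-trans (pivot-delete-first-two _ (stage-simple c λ′ (withPairs c λ′ (suc e) f)) (stage-pivotEdge c λ′))
      (HasPivotMinor-trans (HasPivotMinor-≗ᴳ (λ x y → stage-pivot c λ′ _ _ (pending x) (pending y)))
        (pivot-pairs c e (suc λ′) f λ′+1+e≡k c<t f-pending))
    where
    λ′+1+e≡k = trans (sym (+-suc λ′ e)) λ′+e+1≡k
    pending = withPairs-pending c (suc λ′) e f λ′+1+e≡k c<t f-pending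

  vertices : Fin n → Node
  vertices x = vtx (toℕ x)

  pivot-stages : ∀ c′ s c → s + c ≡ c′ → suc c′ ≡ t →
    HasPivotMinor (stage c 0 on hostNodes (suc s) c) (stage c′ k on vertices)
  pivot-stages c′ zero c refl c′+1≡t = pivot-pairs c′ k 0 vertices refl (subst (c′ <_) c′+1≡t ≤-refl) toℕ<n
  pivot-stages c′ (suc s) c s+1+c≡c′ c′+1≡t =
    HasPivotMinor-trans (pivot-pairs c k 0 (hostNodes (suc s) (suc c)) refl c<t pending)
      (HasPivotMinor-trans (HasPivotMinor-≗ᴳ (λ x y → stage-complete c c+1<t _ _ (pending x) (pending y)))
        (pivot-stages c′ s (suc c) s+c+1≡c′ c′+1≡t))
    where
    s+c+1≡c′ : s + suc c ≡ c′
    s+c+1≡c′ = trans (+-suc s c) s+1+c≡c′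
    pending = hostNodes-pending (suc s) (suc c) (trans (cong suc s+c+1≡c′) c′+1≡t)
    c+1<t : suc c < t
    c+1<t = subst (suc c <_) c′+1≡t (s≤s (subst (suc c ≤_) s+c+1≡c′ (m≤n+m (suc c) s)))
    c<t : c < t
    c<t = <-trans (n<1+n c) c+1<t

  host-hasPivotMinor : ∀ c′ → suc c′ ≡ t → HasPivotMinor (host on hostNodes t 0) (A on toℕ {n})
  host-hasPivotMinor c′ refl =
    HasPivotMinor-trans (HasPivotMinor-≗ᴳ (λ x y → host≡stage₀ (s≤s z≤n) (hostNodes t 0 x) (hostNodes t 0 y)))
      (HasPivotMinor-trans (pivot-stages c′ c′ 0 (+-identityʳ c′) refl)
        (HasPivotMinor-≗ᴳ (λ x y → stage-last c′ refl (toℕ x) (toℕ y) (toℕ<n x) (toℕ<n y))))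

  host-simple : 1 ≤ t → ∀ {m} (f : Fin m → Node) → IsSimple (host on f)
  host-simple 1≤t f =
    (λ x y → trans (host≡stage₀ 1≤t (f x) (f y)) (trans (stage-sym 0 0 (f x) (f y)) (sym (host≡stage₀ 1≤t (f y) (f x))))) ,
    (λ x → trans (host≡stage₀ 1≤t (f x) (f x)) (stage-loop 0 0 (f x)))

-- Path-decompositions from interval models

∣p∣≤-colouring : ∀ {m r} (p : Subset m) (col : ∀ x → x ∈ p → Fin r) →
  (∀ {x y} (x∈p : x ∈ p) (y∈p : y ∈ p) → col x x∈p ≡ col y y∈p → x ≡ y) → ∣ p ∣ ≤ r
∣p∣≤-colouring []            col injective = z≤n
∣p∣≤-colouring (outside ∷ p) col injective =
  ∣p∣≤-colouring p (λ y y∈p → col (suc y) (there y∈p)) λ x∈p y∈p eq → suc-injective (injective (there x∈p) (there y∈p) eq)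
∣p∣≤-colouring {r = zero}  (inside ∷ p) col injective with col zero here
... | ()
∣p∣≤-colouring {r = suc r} (inside ∷ p) col injective =
  s≤s (∣p∣≤-colouring p col′ λ {x} {y} x∈p y∈p eq →
    suc-injective (injective (there x∈p) (there y∈p) (punchOut-injective (distinct x x∈p) (distinct y y∈p) eq)))
  where
  distinct : ∀ y (y∈p : y ∈ p) → col zero here ≢ col (suc y) (there y∈p)
  distinct y y∈p eq with injective here (there y∈p) eq
  ... | ()
  col′ : ∀ y → y ∈ p → Fin r
  col′ y y∈p = punchOut (distinct y y∈p)

∈-tabulate⁺ : ∀ {m} (f : Fin m → Bool) x → f x ≡ true → x ∈ tabulate f
∈-tabulate⁺ f x fx = lookup⇒[]= x (tabulate f) (trans (lookup∘tabulate f x) fx)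

∈-tabulate⁻ : ∀ {m} (f : Fin m → Bool) x → x ∈ tabulate f → f x ≡ true
∈-tabulate⁻ f x x∈ = trans (sym (lookup∘tabulate f x)) ([]=⇒lookup x∈)

record IntervalModel {m} (H : Adj m) (w : ℕ) : Set where
  field
    lo hi      : Fin m → ℕ
    horizon    : ℕ
    colour     : Fin m → Fin (suc w)
    hi≤horizon : ∀ v → hi v ≤ horizon
    lo≤hi      : ∀ v → lo v ≤ hi v

  During : Fin m → ℕ → Set
  During v τ = lo v ≤ τ × τ ≤ hi v

  field
    edge-overlap    : ∀ u v → H u v ≡ true → ∃ λ τ → During u τ × During v τ
    colour-injective : ∀ {u v τ} → During u τ → During v τ → colour u ≡ colour v → u ≡ v

-- the bags are the sets of intervals alive at the times 0, …, horizon
IntervalModel⇒PathWidth≤ : ∀ {m w} {H : Adj m} → IntervalModel H w → PathWidth≤ H w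
IntervalModel⇒PathWidth≤ {m} {w} {H} I =
  suc horizon , bag , covers , edge-covered , consecutive , small
  where
  open IntervalModel I
  during? : ℕ → Fin m → Bool
  during? τ v = (lo v <ᵇ suc τ) ∧ (τ <ᵇ suc (hi v))
  during⇒ : ∀ τ v → During v τ → during? τ v ≡ true
  during⇒ τ v (lo≤τ , τ≤hi) rewrite <ᵇ-true (s≤s lo≤τ) | <ᵇ-true (s≤s τ≤hi) = refl
  ⇒during : ∀ τ v → during? τ v ≡ true → During v τ
  ⇒during τ v e = ≤-pred (<ᵇ-true⇒< _ _ (proj₁ (∧-true⇒ e))) , ≤-pred (<ᵇ-true⇒< _ _ (proj₂ (∧-true⇒ e)))
  bag : Fin (suc horizon) → Subset m
  bag i = tabulate (during? (toℕ i))
  time : ∀ τ → τ ≤ horizon → Fin (suc horizon)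
  time τ τ≤h = fromℕ< (s≤s τ≤h)
  ∈bag : ∀ v τ (τ≤h : τ ≤ horizon) → During v τ → v ∈ bag (time τ τ≤h)
  ∈bag v τ τ≤h d = ∈-tabulate⁺ _ v (subst (λ τ → during? τ v ≡ true) (sym (toℕ-fromℕ< (s≤s τ≤h))) (during⇒ τ v d))
  bag⇒ : ∀ v i → v ∈ bag i → During v (toℕ i)
  bag⇒ v i v∈ = ⇒during (toℕ i) v (∈-tabulate⁻ _ v v∈)
  covers : ∀ v → ∃ λ i → v ∈ bag i
  covers v = time (lo v) lo≤h , ∈bag v (lo v) lo≤h (≤-refl , lo≤hi v)
    where lo≤h = ≤-trans (lo≤hi v) (hi≤horizon v)
  edge-covered : ∀ u v → H u v ≡ true → ∃ λ i → u ∈ bag i × v ∈ bag i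
  edge-covered u v uv with edge-overlap u v uv
  ... | τ , du , dv = time τ τ≤h , ∈bag u τ τ≤h du , ∈bag v τ τ≤h dv
    where τ≤h = ≤-trans (proj₂ du) (hi≤horizon u)
  consecutive : ∀ v (i j l : Fin (suc horizon)) → toℕ i ≤ toℕ j → toℕ j ≤ toℕ l → v ∈ bag i → v ∈ bag l → v ∈ bag j
  consecutive v i j l i≤j j≤l v∈i v∈l =
    ∈-tabulate⁺ _ v (during⇒ (toℕ j) v (≤-trans (proj₁ (bag⇒ v i v∈i)) i≤j , ≤-trans j≤l (proj₂ (bag⇒ v l v∈l))))
  small : ∀ i → ∣ bag i ∣ ≤ suc w
  small i = ∣p∣≤-colouring (bag i) (λ v _ → colour v) λ {u} {v} u∈ v∈ → colour-injective (bag⇒ u i u∈) (bag⇒ v i v∈)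

PathWidth≤-small : ∀ {m w} (H : Adj m) → m ≤ suc w → PathWidth≤ H w
PathWidth≤-small H m≤w+1 = IntervalModel⇒PathWidth≤ (record
  { lo = λ _ → 0 ; hi = λ _ → 0 ; horizon = 0
  ; colour = λ v → inject≤ v m≤w+1
  ; hi≤horizon = λ _ → z≤n ; lo≤hi = λ _ → z≤n
  ; edge-overlap = λ _ _ _ → 0 , (z≤n , z≤n) , (z≤n , z≤n)
  ; colour-injective = λ _ _ → inject≤-injective m≤w+1 m≤w+1 _ _ })

PathWidth≤-edgeless : ∀ {m w} (H : Adj m) → (∀ u v → H u v ≡ false) → PathWidth≤ H w
PathWidth≤-edgeless {m} H edgeless = IntervalModel⇒PathWidth≤ (record
  { lo = toℕ ; hi = toℕ ; horizon = m
  ; colour = λ _ → zero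
  ; hi≤horizon = λ v → <⇒≤ (toℕ<n v) ; lo≤hi = λ _ → ≤-refl
  ; edge-overlap = λ u v uv → contradiction (trans (sym uv) (edgeless u v)) λ ()
  ; colour-injective = λ (u≤τ , τ≤u) (v≤τ , τ≤v) _ →
      toℕ-injective (trans (≤-antisym u≤τ τ≤u) (≤-antisym τ≤v v≤τ)) })

data Slot : Set where
  pSlot : ℕ → Slot
  zSlot qSlot : Slot

module Intervals (t′ k′ : ℕ) where

  open Layout (suc t′) (suc k′)

  t k : ℕ
  t = suc t′
  k = suc k′

  stageTime : ℕ → ℕ
  stageTime c = c * (k + k)

  -- the vertices of H, classified by the shape of their interval; the index is a colour class
  data Kind : Slot → Set where
    start₀ : Kind zSlot
    start₁ : Kind qSlot
    inner  : (c : ℕ) → Kind zSlot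
    end₁   : Kind (pSlot k′)
    end₂   : Kind qSlot
    pk     : (c l : ℕ) → Kind (pSlot l)
    qk     : (c l : ℕ) → Kind qSlot
    qlast₀ : Kind zSlot
    qlast  : (l : ℕ) → Kind (pSlot l)

  toNode : ∀ {s} → Kind s → Node
  toNode start₀    = vtx 0
  toNode start₁    = vtx 1
  toNode (inner c) = vtx (2 + c)
  toNode end₁      = vtx (1 + t)
  toNode end₂      = vtx (2 + t)
  toNode (pk c l)  = pvtx c l
  toNode (qk c l)  = qvtx c l
  toNode qlast₀    = qvtx t′ 0
  toNode (qlast l) = qvtx t′ (suc l)

  Valid : ∀ {s} → Kind s → Set
  Valid (inner c) = c < t′
  Valid (pk c l)  = c < t × l < k
  Valid (qk c l)  = c < t′ × l < k
  Valid (qlast l) = suc l < k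
  Valid _         = ⊤

  -- Stage c occupies the times stageTime c + 1, …, stageTime (c + 1), two for each l < k:
  -- p c l and q c l meet at time stageTime c + 2l + 1.
  lo hi : ∀ {s} → Kind s → ℕ
  lo start₀         = 0
  lo start₁         = 0
  lo (inner c)      = suc (stageTime c)
  lo end₁           = suc (stageTime t)
  lo end₂           = suc (stageTime t)
  lo (pk zero l)    = 0
  lo (pk (suc c) l) = 2 + (stageTime c + (l + l))
  lo (qk c l)       = 1 + (stageTime c + (l + l))
  lo qlast₀         = 1 + (stageTime t′ + 0)
  lo (qlast l)      = 1 + (stageTime t′ + (suc l + suc l))
  hi start₀         = 0
  hi start₁         = 0
  hi (inner c)      = stageTime (suc c)
  hi end₁           = suc (stageTime t)
  hi end₂           = suc (stageTime t)
  hi (pk c l)       = 1 + (stageTime c + (l + l))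
  hi (qk c l)       = 2 + (stageTime c + (l + l))
  hi qlast₀         = suc (stageTime t)
  hi (qlast l)      = suc (stageTime t)

  During : ∀ {s} → Kind s → ℕ → Set
  During κ τ = lo κ ≤ τ × τ ≤ hi κ

  separated : ∀ {s₁ s₂} (κ₁ : Kind s₁) (κ₂ : Kind s₂) {τ} → hi κ₁ < lo κ₂ → During κ₁ τ → During κ₂ τ → ⊥
  separated _ _ hi<lo (_ , τ≤hi) (lo≤τ , _) = <-irrefl refl (<-≤-trans (≤-<-trans τ≤hi hi<lo) lo≤τ)

  double-< : ∀ {l m} → l < m → 2 + (l + l) ≤ m + m
  double-< {l} {m} l<m = subst (_≤ m + m) (cong suc (+-suc l l)) (+-mono-≤ l<m l<m)

  stageTime-mono : ∀ {c c′} → c ≤ c′ → stageTime c ≤ stageTime c′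
  stageTime-mono = *-monoˡ-≤ (k + k)

  stageTime-slot : ∀ c {l} → l < k → 2 + (stageTime c + (l + l)) ≤ stageTime (suc c)
  stageTime-slot c {l} l<k =
    subst (_≤ stageTime (suc c)) (cong (2 +_) (+-comm (l + l) (stageTime c))) (+-monoˡ-≤ (stageTime c) (double-< l<k))

  slotTime-< : ∀ x {l l′} → l < l′ → 2 + (x + (l + l)) ≤ x + (l′ + l′)
  slotTime-< x {l} {l′} l<l′ =
    subst (_≤ x + (l′ + l′)) (trans (+-suc x (suc (l + l))) (cong suc (+-suc x (l + l)))) (+-monoʳ-≤ x (double-< l<l′))

  inner-disjoint : ∀ c₁ c₂ {τ} → During (inner c₁) τ → During (inner c₂) τ → c₁ ≡ c₂
  inner-disjoint c₁ c₂ d₁ d₂ with <-cmp c₁ c₂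
  ... | tri< c₁<c₂ _ _ = ⊥-elim (separated (inner c₁) (inner c₂) (s≤s (stageTime-mono c₁<c₂)) d₁ d₂)
  ... | tri≈ _ c₁≡c₂ _ = c₁≡c₂
  ... | tri> _ _ c₂<c₁ = ⊥-elim (separated (inner c₂) (inner c₁) (s≤s (stageTime-mono c₂<c₁)) d₂ d₁)

  pk-before : ∀ {c₁ c₂} l → c₁ < c₂ → hi (pk c₁ l) < lo (pk c₂ l)
  pk-before {c₂ = suc c₂} l (s≤s c₁≤c₂) = s≤s (s≤s (+-monoˡ-≤ (l + l) (stageTime-mono c₁≤c₂)))

  pk-disjoint : ∀ c₁ c₂ l {τ} → During (pk c₁ l) τ → During (pk c₂ l) τ → c₁ ≡ c₂
  pk-disjoint c₁ c₂ l d₁ d₂ with <-cmp c₁ c₂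
  ... | tri< c₁<c₂ _ _ = ⊥-elim (separated (pk c₁ l) (pk c₂ l) (pk-before l c₁<c₂) d₁ d₂)
  ... | tri≈ _ c₁≡c₂ _ = c₁≡c₂
  ... | tri> _ _ c₂<c₁ = ⊥-elim (separated (pk c₂ l) (pk c₁ l) (pk-before l c₂<c₁) d₂ d₁)

  qk-before : ∀ {c₁ c₂ l₁} l₂ → c₁ < c₂ → l₁ < k → hi (qk c₁ l₁) < lo (qk c₂ l₂)
  qk-before {c₁} {c₂} l₂ c₁<c₂ l₁<k =
    s≤s (≤-trans (stageTime-slot c₁ l₁<k) (≤-trans (stageTime-mono c₁<c₂) (m≤m+n (stageTime c₂) (l₂ + l₂))))

  qk-disjoint : ∀ c₁ l₁ c₂ l₂ → l₁ < k → l₂ < k → ∀ {τ} → During (qk c₁ l₁) τ → During (qk c₂ l₂) τ →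
    qvtx c₁ l₁ ≡ qvtx c₂ l₂
  qk-disjoint c₁ l₁ c₂ l₂ l₁<k l₂<k d₁ d₂ with <-cmp c₁ c₂
  ... | tri< c₁<c₂ _ _ = ⊥-elim (separated (qk c₁ l₁) (qk c₂ l₂) (qk-before l₂ c₁<c₂ l₁<k) d₁ d₂)
  ... | tri> _ _ c₂<c₁ = ⊥-elim (separated (qk c₂ l₂) (qk c₁ l₁) (qk-before l₁ c₂<c₁ l₂<k) d₂ d₁)
  ... | tri≈ _ refl _ with <-cmp l₁ l₂
  ...   | tri< l₁<l₂ _ _ = ⊥-elim (separated (qk c₁ l₁) (qk c₁ l₂) (s≤s (slotTime-< (stageTime c₁) l₁<l₂)) d₁ d₂)
  ...   | tri≈ _ refl _  = refl
  ...   | tri> _ _ l₂<l₁ = ⊥-elim (separated (qk c₁ l₂) (qk c₁ l₁) (s≤s (slotTime-< (stageTime c₁) l₂<l₁)) d₂ d₁)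

  inner-before-qlast₀ : ∀ {c} → c < t′ → hi (inner c) < lo qlast₀
  inner-before-qlast₀ {c} c<t′ = s≤s (≤-trans (stageTime-mono c<t′) (m≤m+n (stageTime t′) 0))

  qk-before-end₂ : ∀ {c l} → c < t′ → l < k → hi (qk c l) < lo end₂
  qk-before-end₂ {c} c<t′ l<k = s≤s (≤-trans (stageTime-slot c l<k) (stageTime-mono (m≤n⇒m≤1+n c<t′)))

  pk-before-end₁ : ∀ {c} → c < t → hi (pk c k′) < lo end₁
  pk-before-end₁ {c} c<t = s≤s (≤-trans (n≤1+n _) (≤-trans (stageTime-slot c ≤-refl) (stageTime-mono c<t)))

  pk-before-qlast : ∀ {c} l → c < t → hi (pk c l) < lo (qlast l)
  pk-before-qlast {c} l (s≤s c≤t′) =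
    ≤-trans (s≤s (s≤s (+-monoˡ-≤ (l + l) (stageTime-mono c≤t′)))) (≤-trans (slotTime-< (stageTime t′) (n<1+n l)) (n≤1+n _))

  disjoint : ∀ {s} (κ₁ κ₂ : Kind s) → Valid κ₁ → Valid κ₂ → ∀ {τ} → During κ₁ τ → During κ₂ τ →
    toNode κ₁ ≡ toNode κ₂
  disjoint start₀       start₀       _ _ _ _ = refl
  disjoint start₀       (inner c)    _ _ d₁ d₂ = ⊥-elim (separated start₀ (inner c) (s≤s z≤n) d₁ d₂)
  disjoint start₀       qlast₀       _ _ d₁ d₂ = ⊥-elim (separated start₀ qlast₀ (s≤s z≤n) d₁ d₂)
  disjoint (inner c)    start₀       _ _ d₁ d₂ = ⊥-elim (separated start₀ (inner c) (s≤s z≤n) d₂ d₁)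
  disjoint (inner c₁)   (inner c₂)   _ _ d₁ d₂ = cong (λ c → vtx (2 + c)) (inner-disjoint c₁ c₂ d₁ d₂)
  disjoint (inner c)    qlast₀       v _ d₁ d₂ = ⊥-elim (separated (inner c) qlast₀ (inner-before-qlast₀ v) d₁ d₂)
  disjoint qlast₀       start₀       _ _ d₁ d₂ = ⊥-elim (separated start₀ qlast₀ (s≤s z≤n) d₂ d₁)
  disjoint qlast₀       (inner c)    _ v d₁ d₂ = ⊥-elim (separated (inner c) qlast₀ (inner-before-qlast₀ v) d₂ d₁)
  disjoint qlast₀       qlast₀       _ _ _ _ = refl
  disjoint start₁       start₁       _ _ _ _ = refl
  disjoint start₁       end₂         _ _ d₁ d₂ = ⊥-elim (separated start₁ end₂ (s≤s z≤n) d₁ d₂)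
  disjoint start₁       (qk c l)     _ _ d₁ d₂ = ⊥-elim (separated start₁ (qk c l) (s≤s z≤n) d₁ d₂)
  disjoint end₂         start₁       _ _ d₁ d₂ = ⊥-elim (separated start₁ end₂ (s≤s z≤n) d₂ d₁)
  disjoint end₂         end₂         _ _ _ _ = refl
  disjoint end₂         (qk c l)     _ (c<t′ , l<k) d₁ d₂ = ⊥-elim (separated (qk c l) end₂ (qk-before-end₂ c<t′ l<k) d₂ d₁)
  disjoint (qk c l)     start₁       _ _ d₁ d₂ = ⊥-elim (separated start₁ (qk c l) (s≤s z≤n) d₂ d₁)
  disjoint (qk c l)     end₂         (c<t′ , l<k) _ d₁ d₂ = ⊥-elim (separated (qk c l) end₂ (qk-before-end₂ c<t′ l<k) d₁ d₂)
  disjoint (qk c₁ l₁)   (qk c₂ l₂)   (_ , l₁<k) (_ , l₂<k) d₁ d₂ = qk-disjoint c₁ l₁ c₂ l₂ l₁<k l₂<k d₁ d₂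
  disjoint end₁         end₁         _ _ _ _ = refl
  disjoint end₁         (pk c .k′)   _ (c<t , _) d₁ d₂ = ⊥-elim (separated (pk c k′) end₁ (pk-before-end₁ c<t) d₂ d₁)
  disjoint end₁         (qlast .k′)  _ k<k d₁ d₂ = ⊥-elim (<-irrefl refl k<k)
  disjoint (pk c .k′)   end₁         (c<t , _) _ d₁ d₂ = ⊥-elim (separated (pk c k′) end₁ (pk-before-end₁ c<t) d₁ d₂)
  disjoint (pk c₁ l)    (pk c₂ .l)   _ _ d₁ d₂ = cong (λ c → pvtx c l) (pk-disjoint c₁ c₂ l d₁ d₂)
  disjoint (pk c l)     (qlast .l)   (c<t , _) _ d₁ d₂ = ⊥-elim (separated (pk c l) (qlast l) (pk-before-qlast l c<t) d₁ d₂)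
  disjoint (qlast .k′)  end₁         k<k _ d₁ d₂ = ⊥-elim (<-irrefl refl k<k)
  disjoint (qlast l)    (pk c .l)    _ (c<t , _) d₁ d₂ = ⊥-elim (separated (pk c l) (qlast l) (pk-before-qlast l c<t) d₂ d₁)
  disjoint (qlast l)    (qlast .l)   _ _ _ _ = refl

  lastQ : ℕ → Σ Slot Kind
  lastQ zero    = zSlot , qlast₀
  lastQ (suc l) = pSlot l , qlast l

  classify : Node → Σ Slot Kind
  classify (vtx zero)          = zSlot , start₀
  classify (vtx (suc zero))    = qSlot , start₁
  classify (vtx (suc (suc a))) =
    if a <ᵇ t′ then zSlot , inner a else if a ≡ᵇ t′ then pSlot k′ , end₁ else qSlot , end₂
  classify (pvtx c l)          = pSlot l , pk c l
  classify (qvtx c l)          = if c ≡ᵇ t′ then lastQ l else qSlot , qk c l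

  classify-correct : ∀ x → Pending 0 0 x → toNode (proj₂ (classify x)) ≡ x × Valid (proj₂ (classify x))
  classify-correct (vtx zero)          _ = refl , tt
  classify-correct (vtx (suc zero))    _ = refl , tt
  classify-correct (vtx (suc (suc a))) a<n with a <ᵇ t′ in a<t′
  ... | true = refl , <ᵇ-true⇒< a t′ a<t′
  ... | false with a ≡ᵇ t′ in a≡t′
  ...   | true  = cong (λ a → vtx (2 + a)) (sym (≡ᵇ-true⇒≡ a t′ a≡t′)) , tt
  ...   | false = cong (λ a → vtx (2 + a)) (sym a≡t) , tt
    where
    a≡t : a ≡ t
    a≡t = ≤-antisym (≤-pred (≤-pred (≤-pred a<n))) (≤∧≢⇒< (<ᵇ-false⇒≥ a t′ a<t′) (≡ᵇ-false⇒≢ a t′ a≡t′ ∘ sym))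
  classify-correct (pvtx c l) (l<k , c<t , _) = refl , c<t , l<k
  classify-correct (qvtx c l) (l<k , c<t , _) with c ≡ᵇ t′ in c≡t′
  ... | false = refl , ≤∧≢⇒< (≤-pred c<t) (≡ᵇ-false⇒≢ c t′ c≡t′) , l<k
  ... | true with ≡ᵇ-true⇒≡ c t′ c≡t′ | l
  ...   | refl | zero  = refl , tt
  ...   | refl | suc l = refl , l<k

  horizon : ℕ
  horizon = suc (stageTime t)

  slot-before-end : ∀ {c l} → c < t → l < k → 2 + (stageTime c + (l + l)) ≤ stageTime t
  slot-before-end {c} c<t l<k = ≤-trans (stageTime-slot c l<k) (stageTime-mono c<t)

  lo≤hi : ∀ {s} (κ : Kind s) → Valid κ → lo κ ≤ hi κ
  lo≤hi start₀         _ = z≤n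
  lo≤hi start₁         _ = z≤n
  lo≤hi (inner c)      _ = +-monoˡ-≤ (stageTime c) (s≤s z≤n)
  lo≤hi end₁           _ = ≤-refl
  lo≤hi end₂           _ = ≤-refl
  lo≤hi (pk zero l)    _ = z≤n
  lo≤hi (pk (suc c) l) _ = s≤s (+-monoˡ-≤ (l + l) (+-monoˡ-≤ (stageTime c) {1} {k + k} (s≤s z≤n)))
  lo≤hi (qk c l)       _ = n≤1+n _
  lo≤hi qlast₀         _ = s≤s (≤-trans (≤-reflexive (+-identityʳ _)) (stageTime-mono (n≤1+n t′)))
  lo≤hi (qlast l)      l+1<k =
    s≤s (subst (_≤ stageTime t) (+-comm _ (stageTime t′)) (+-monoˡ-≤ (stageTime t′) (+-mono-≤ l+1≤k l+1≤k)))
    where l+1≤k = <⇒≤ l+1<k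

  hi≤horizon : ∀ {s} (κ : Kind s) → Valid κ → hi κ ≤ horizon
  hi≤horizon start₀    _ = z≤n
  hi≤horizon start₁    _ = z≤n
  hi≤horizon (inner c) c<t′ = ≤-trans (stageTime-mono (m≤n⇒m≤1+n c<t′)) (n≤1+n _)
  hi≤horizon end₁      _ = ≤-refl
  hi≤horizon end₂      _ = ≤-refl
  hi≤horizon (pk c l)  (c<t , l<k) = ≤-trans (n≤1+n _) (≤-trans (slot-before-end c<t l<k) (n≤1+n _))
  hi≤horizon (qk c l)  (c<t′ , l<k) = ≤-trans (slot-before-end (m≤n⇒m≤1+n c<t′) l<k) (n≤1+n _)
  hi≤horizon qlast₀    _ = ≤-refl
  hi≤horizon (qlast l) _ = ≤-refl

  lastQ-at-start : ∀ l → l < k → During (proj₂ (lastQ l)) (1 + (stageTime t′ + (l + l)))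
  lastQ-at-start zero    _     = ≤-refl , lo≤hi qlast₀ tt
  lastQ-at-start (suc l) l+1<k = ≤-refl , lo≤hi (qlast l) l+1<k

  lastQ-at-horizon : ∀ l → l < k → During (proj₂ (lastQ l)) horizon
  lastQ-at-horizon zero    _     = lo≤hi qlast₀ tt , ≤-refl
  lastQ-at-horizon (suc l) l+1<k = lo≤hi (qlast l) l+1<k , ≤-refl

module HostPathDecomposition (t′ k′ : ℕ) (A : ℕ → ℕ → Bool) (A-sym : ∀ a b → A a b ≡ A b a)
                             (A-loop : ∀ a → A a a ≡ false) (S : CutSequence (3 + suc t′) (suc k′) A) where
  open CutSequence S
  open Construction (suc t′) (suc k′) A A-sym A-loop S
  open Intervals t′ k′

  Overlap : Node → Node → Set
  Overlap x y = ∃ λ τ → During (proj₂ (classify x)) τ × During (proj₂ (classify y)) τ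

  Overlap-sym : ∀ x y → Overlap x y → Overlap y x
  Overlap-sym _ _ (τ , dx , dy) = τ , dy , dx

  classify-inner : ∀ c → c < t′ → classify (vtx (2 + c)) ≡ (zSlot , inner c)
  classify-inner c c<t′ rewrite <ᵇ-true c<t′ = refl

  classify-end₁ : classify (vtx (1 + t)) ≡ (pSlot k′ , end₁)
  classify-end₁ rewrite <ᵇ-false (≤-refl {t′}) | ≡ᵇ-refl t′ = refl

  classify-end₂ : classify (vtx (2 + t)) ≡ (qSlot , end₂)
  classify-end₂ rewrite <ᵇ-false (n≤1+n t′) | ≢⇒≡ᵇ-false {t} {t′} (<⇒≢ (n<1+n t′) ∘ sym) = refl

  classify-qk : ∀ c l → c < t′ → classify (qvtx c l) ≡ (qSlot , qk c l)
  classify-qk c l c<t′ rewrite ≢⇒≡ᵇ-false (<⇒≢ c<t′) = refl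

  classify-lastQ : ∀ l → classify (qvtx t′ l) ≡ lastQ l
  classify-lastQ l rewrite ≡ᵇ-refl t′ = refl

  overlap-VV : ∀ a b → keptEdge a b ≡ true → Overlap (vtx a) (vtx b)
  overlap-VV a b kept with ∨-true⇒ kept
  ... | inj₁ first with isPair-true a b 0 1 first
  ...   | inj₁ (refl , refl) = 0 , (z≤n , z≤n) , (z≤n , z≤n)
  ...   | inj₂ (refl , refl) = 0 , (z≤n , z≤n) , (z≤n , z≤n)
  overlap-VV a b kept | inj₂ last with isPair-true a b (1 + t) (2 + t) last
  ...   | inj₁ (refl , refl) rewrite classify-end₁ | classify-end₂ = horizon , (≤-refl , ≤-refl) , (≤-refl , ≤-refl)
  ...   | inj₂ (refl , refl) rewrite classify-end₁ | classify-end₂ = horizon , (≤-refl , ≤-refl) , (≤-refl , ≤-refl)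

  overlap-VP : ∀ a c j → PendingAt 0 0 c j → hostVP a c j ≡ true → Overlap (vtx a) (pvtx c j)
  overlap-VP a c j (j<k , c<t , _) e with ∨-true⇒ (proj₁ (∧-true⇒ e))
  ... | inj₂ c≡0∧a≡0 with ≡ᵇ-true⇒≡ c 0 (proj₁ (∧-true⇒ c≡0∧a≡0)) | ≡ᵇ-true⇒≡ a 0 (proj₂ (∧-true⇒ c≡0∧a≡0))
  ...   | refl | refl = 0 , (z≤n , z≤n) , (z≤n , z≤n)
  overlap-VP a c j (j<k , c<t , _) e | inj₁ a≡c+1 with ≡ᵇ-true⇒≡ (suc a) (2 + c) a≡c+1
  overlap-VP .1 zero j (j<k , c<t , _) e | inj₁ _ | refl = 0 , (z≤n , z≤n) , (z≤n , z≤n)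
  overlap-VP .(2 + c) (suc c) j (j<k , s≤s c<t′ , _) e | inj₁ _ | refl rewrite classify-inner c c<t′ =
    2 + (stageTime c + (j + j)) ,
    (s≤s (≤-trans (m≤m+n (stageTime c) (j + j)) (n≤1+n _)) , stageTime-slot c j<k) ,
    (≤-refl , s≤s (≤-trans (≤-trans (n≤1+n _) (stageTime-slot c j<k)) (m≤m+n _ _)))

  overlap-VQ : ∀ a c l → PendingAt 0 0 c l → hostVQ a c l ≡ true → Overlap (vtx a) (qvtx c l)
  overlap-VQ a c l (l<k , c<t , _) e with <-cmp c t′ | ∨-true⇒ (proj₁ (∧-true⇒ e))
  ... | tri≈ _ refl _ | inj₁ a≡t+1 rewrite ≡ᵇ-true⇒≡ a (1 + t) a≡t+1 | classify-end₁ | classify-lastQ l =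
    horizon , (≤-refl , ≤-refl) , lastQ-at-horizon l l<k
  ... | tri≈ _ refl _ | inj₂ a≡t+2 rewrite ≡ᵇ-true⇒≡ a (2 + t) (proj₂ (∧-true⇒ a≡t+2)) | classify-end₂ | classify-lastQ l =
    horizon , (≤-refl , ≤-refl) , lastQ-at-horizon l l<k
  ... | tri< c<t′ _ _ | inj₁ a≡c+2 rewrite ≡ᵇ-true⇒≡ a (2 + c) a≡c+2 | classify-inner c c<t′ | classify-qk c l c<t′ =
    1 + (stageTime c + (l + l)) ,
    (s≤s (m≤m+n _ _) , ≤-trans (n≤1+n _) (stageTime-slot c l<k)) , (≤-refl , n≤1+n _)
  ... | tri< c<t′ _ _ | inj₂ last = contradiction (≡ᵇ-true⇒≡ (suc c) t (proj₁ (∧-true⇒ last))) (<⇒≢ (s≤s c<t′))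
  ... | tri> _ _ c>t′ | _ = contradiction (<-≤-trans c<t c>t′) (<-irrefl refl)

  overlap-PQ : ∀ c j c′ l → PendingAt 0 0 c j → PendingAt 0 0 c′ l → hostPQ c j c′ l ≡ true →
    Overlap (pvtx c j) (qvtx c′ l)
  overlap-PQ c j c′ l (j<k , c<t , _) (l<k , c′<t , _) e with ∨-true⇒ e
  ... | inj₁ same with ≡ᵇ-true⇒≡ c c′ (proj₁ (∧-true⇒ same)) | ≡ᵇ-true⇒≡ j l (proj₂ (∧-true⇒ same))
  ...   | refl | refl with <-cmp c t′
  ...     | tri≈ _ refl _ rewrite classify-lastQ l =
    1 + (stageTime t′ + (l + l)) , (lo≤hi (pk t′ l) (c<t , l<k) , ≤-refl) , lastQ-at-start l l<k
  ...     | tri< c<t′ _ _ rewrite classify-qk c l c<t′ =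
    1 + (stageTime c + (l + l)) , (lo≤hi (pk c l) (c<t , l<k) , ≤-refl) , (≤-refl , n≤1+n _)
  ...     | tri> _ _ c>t′ = contradiction (<-≤-trans c<t c>t′) (<-irrefl refl)
  overlap-PQ c j c′ l (j<k , c<t , _) (l<k , c′<t , _) e | inj₂ next
    with ≡ᵇ-true⇒≡ c (suc c′) (proj₁ (∧-true⇒ next)) | transition-upper c′ j l (proj₂ (∧-true⇒ next))
  ... | refl | j≤l , _ rewrite classify-qk c′ l (≤-pred c<t) =
    2 + (stageTime c′ + (l + l)) ,
    (s≤s (s≤s (+-monoʳ-≤ (stageTime c′) (+-mono-≤ j≤l j≤l))) ,
     s≤s (≤-trans (≤-trans (n≤1+n _) (stageTime-slot c′ l<k)) (m≤m+n _ _))) ,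
    (n≤1+n _ , ≤-refl)

  host-overlap : ∀ x y → Pending 0 0 x → Pending 0 0 y → host x y ≡ true → Overlap x y
  host-overlap (vtx a)    (vtx b)     _ _ e = overlap-VV a b (proj₁ (∧-true⇒ e))
  host-overlap (vtx a)    (pvtx c j)  _ p e = overlap-VP a c j p e
  host-overlap (pvtx c j) (vtx a)     p _ e = Overlap-sym (vtx a) (pvtx c j) (overlap-VP a c j p e)
  host-overlap (vtx a)    (qvtx c l)  _ p e = overlap-VQ a c l p e
  host-overlap (qvtx c l) (vtx a)     p _ e = Overlap-sym (vtx a) (qvtx c l) (overlap-VQ a c l p e)
  host-overlap (pvtx c j) (qvtx c′ l) p p′ e = overlap-PQ c j c′ l p p′ e
  host-overlap (qvtx c′ l) (pvtx c j) p′ p e = Overlap-sym (pvtx c j) (qvtx c′ l) (overlap-PQ c j c′ l p p′ e)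

  slotIndex : Slot → ℕ
  slotIndex (pSlot l) = l
  slotIndex zSlot     = k
  slotIndex qSlot     = suc k

  pSlot-valid : ∀ {l} (κ : Kind (pSlot l)) → Valid κ → l < k
  pSlot-valid end₁      _           = ≤-refl
  pSlot-valid (pk c l)  (_ , l<k)   = l<k
  pSlot-valid (qlast l) l+1<k       = <-trans (n<1+n l) l+1<k

  slotIndex<2+k : ∀ {s} (κ : Kind s) → Valid κ → slotIndex s < 2 + k
  slotIndex<2+k {pSlot l} κ v = ≤-trans (pSlot-valid κ v) (m≤n+m k 2)
  slotIndex<2+k {zSlot}   κ v = n≤1+n (suc k)
  slotIndex<2+k {qSlot}   κ v = ≤-refl

  slotIndex-injective : ∀ {s₁ s₂} (κ₁ : Kind s₁) (κ₂ : Kind s₂) → Valid κ₁ → Valid κ₂ →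
    slotIndex s₁ ≡ slotIndex s₂ → s₁ ≡ s₂
  slotIndex-injective {pSlot l₁} {pSlot l₂} _ _ _ _ refl = refl
  slotIndex-injective {pSlot l}  {zSlot}    κ _ v _ refl = contradiction (pSlot-valid κ v) (<-irrefl refl)
  slotIndex-injective {pSlot l}  {qSlot}    κ _ v _ refl = contradiction (<-trans (n<1+n k) (pSlot-valid κ v)) (<-irrefl refl)
  slotIndex-injective {zSlot}    {pSlot l}  _ κ _ v refl = contradiction (pSlot-valid κ v) (<-irrefl refl)
  slotIndex-injective {zSlot}    {zSlot}    _ _ _ _ _    = refl
  slotIndex-injective {zSlot}    {qSlot}    _ _ _ _ ()
  slotIndex-injective {qSlot}    {pSlot l}  _ κ _ v refl = contradiction (<-trans (n<1+n k) (pSlot-valid κ v)) (<-irrefl refl)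
  slotIndex-injective {qSlot}    {zSlot}    _ _ _ _ ()
  slotIndex-injective {qSlot}    {qSlot}    _ _ _ _ _    = refl

  disjoint-Σ : (κ₁ κ₂ : Σ Slot Kind) → proj₁ κ₁ ≡ proj₁ κ₂ → Valid (proj₂ κ₁) → Valid (proj₂ κ₂) →
    ∀ {τ} → During (proj₂ κ₁) τ → During (proj₂ κ₂) τ → toNode (proj₂ κ₁) ≡ toNode (proj₂ κ₂)
  disjoint-Σ (s , κ₁) (.s , κ₂) refl = disjoint κ₁ κ₂

  H : Adj (hostSize t)
  H = host on hostNodes t 0

  private
    node : Fin (hostSize t) → Node
    node = hostNodes t 0
    pending : ∀ v → Pending 0 0 (node v)
    pending = hostNodes-pending t 0 (+-identityʳ t)
    kindOf : Fin (hostSize t) → Σ Slot Kind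
    kindOf v = classify (node v)
    toNode-kindOf : ∀ v → toNode (proj₂ (kindOf v)) ≡ node v
    toNode-kindOf v = proj₁ (classify-correct (node v) (pending v))
    valid : ∀ v → Valid (proj₂ (kindOf v))
    valid v = proj₂ (classify-correct (node v) (pending v))

  intervalModel : IntervalModel H (suc k)
  intervalModel = record
    { lo = λ v → lo (proj₂ (kindOf v))
    ; hi = λ v → hi (proj₂ (kindOf v))
    ; horizon = horizon
    ; colour = λ v → fromℕ< (slotIndex<2+k (proj₂ (kindOf v)) (valid v))
    ; hi≤horizon = λ v → hi≤horizon (proj₂ (kindOf v)) (valid v)
    ; lo≤hi = λ v → lo≤hi (proj₂ (kindOf v)) (valid v)
    ; edge-overlap = λ u v → host-overlap (node u) (node v) (pending u) (pending v)
    ; colour-injective = λ {u} {v} du dv same-colour → hostNodes-injective t 0 (+-identityʳ t) (begin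
        node u                    ≡⟨ sym (toNode-kindOf u) ⟩
        toNode (proj₂ (kindOf u)) ≡⟨ disjoint-Σ (kindOf u) (kindOf v) (same-slot u v same-colour) (valid u) (valid v) du dv ⟩
        toNode (proj₂ (kindOf v)) ≡⟨ toNode-kindOf v ⟩
        node v                    ∎)
    }
    where
    open ≡-Reasoning
    same-slot : ∀ u v → fromℕ< (slotIndex<2+k (proj₂ (kindOf u)) (valid u)) ≡
                          fromℕ< (slotIndex<2+k (proj₂ (kindOf v)) (valid v)) →
                proj₁ (kindOf u) ≡ proj₁ (kindOf v)
    same-slot u v eq = slotIndex-injective (proj₂ (kindOf u)) (proj₂ (kindOf v)) (valid u) (valid v)
      (trans (sym (toℕ-fromℕ< _)) (trans (cong toℕ eq) (toℕ-fromℕ< _)))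

rank0⇒edgeless : ∀ {n} (G : Adj n) → IsSimple G → (∀ v → CutRank≤ G (singleton v) 0) → ∀ u v → G u v ≡ false
rank0⇒edgeless G (_ , loopless) rank0 u v with v ≟ u
... | yes refl = loopless v
... | no  v≢u  = proj₂ (proj₂ (rank0 u) u (trans (isYes≗does (u ≟ u)) (dec-true (u ≟ u) refl))) v
                   (trans (isYes≗does (v ≟ u)) (dec-false (v ≟ u) v≢u))

size-bound-edgeless : ∀ n → n + 6 * 0 ≡ (2 * 0 + 1) * n
size-bound-edgeless = solve-∀

size-bound-triangle : ∀ k → 3 + 6 * k ≡ (2 * k + 1) * 3
size-bound-triangle = solve-∀

size-bound : ∀ t k → (t * (k + k) + (3 + t)) + 6 * k ≡ (2 * k + 1) * (3 + t)
size-bound = solve-∀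

IsomorphicPivotMinor : ∀ {m n} → Adj m → Adj n → Set
IsomorphicPivotMinor H G = Σ ℕ λ p → Σ (Adj p) λ G' → PivotMinor G' H × Isomorphic G' G

IsomorphicPivotMinor-refl : ∀ {n} (G : Adj n) → IsomorphicPivotMinor G G
IsomorphicPivotMinor-refl {n} G = n , G , pm-refl , ↔-id (Fin n) , λ _ _ → refl

sweepConstruction : ∀ {t′ k′} (G : Adj (4 + t′)) → IsSimple G → (σ : Fin (4 + t′) ↔ Fin (4 + t′)) →
  (∀ i → 1 ≤ i → i < 4 + t′ → CutRank≤ G (prefix σ i) (suc k′)) →
  Σ ℕ λ m → Σ (Adj m) λ H → IsSimple H × IsomorphicPivotMinor H G × PathWidth≤ H (2 + k′) ×
    (m + 6 * suc k′ ≤ (2 * suc k′ + 1) * (4 + t′))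
sweepConstruction {t′} {k′} G simple σ prefixRank =
  hostSize t , H , host-simple (s≤s z≤n) (hostNodes t 0) ,
  (4 + t′ , G′ , G′≼H , σ , λ x y → trans (G′≗A x y) (A-toℕ x y)) ,
  IntervalModel⇒PathWidth≤ intervalModel ,
  ≤-reflexive (trans (cong (_+ 6 * suc k′) (hostSize≡ t)) (size-bound t (suc k′)))
  where
  t = suc t′
  open Ordered G simple σ using (A; A-sym; A-loop; A-toℕ; cutRankAt)
  S = cutSequence (4 + t′) k′ A (cutRankAt k′ prefixRank)
  open Construction t (suc k′) A A-sym A-loop S
  open HostPathDecomposition t′ k′ A A-sym A-loop S using (H; intervalModel)
  minor = host-hasPivotMinor t′ refl
  G′ = proj₁ minor
  G′≼H = proj₁ (proj₂ minor)
  G′≗A = proj₂ (proj₂ minor)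

theorem3p2 : (k n : ℕ) (G : Adj n) → IsSimple G → LinearRankWidth≤ G k → 3 ≤ n →
    Σ ℕ λ m → Σ (Adj m) λ H → IsSimple H ×
      (Σ ℕ λ p → Σ (Adj p) λ G' → PivotMinor G' H × Isomorphic G' G) ×
      PathWidth≤ H (suc k) × (m + 6 * k ≤ (2 * k + 1) * n)
theorem3p2 k n G simple (inj₁ n≤1) 3≤n = contradiction (≤-trans 3≤n n≤1) λ { (s≤s ()) }
theorem3p2 zero n G simple (inj₂ (_ , rank0 , _)) _ =
  n , G , simple , IsomorphicPivotMinor-refl G ,
  PathWidth≤-edgeless G (rank0⇒edgeless G simple rank0) , ≤-reflexive (size-bound-edgeless n)
theorem3p2 (suc k′) 3 G simple (inj₂ _) _ =
  3 , G , simple , IsomorphicPivotMinor-refl G ,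
  PathWidth≤-small G (s≤s (s≤s (s≤s z≤n))) , ≤-reflexive (size-bound-triangle (suc k′))
theorem3p2 (suc k′) (suc (suc (suc (suc t′)))) G simple (inj₂ (σ , _ , prefixRank)) _ =
  sweepConstruction G simple σ prefixRank
theorem3p2 (suc k′) 1 G _ (inj₂ _) (s≤s ())
theorem3p2 (suc k′) 2 G _ (inj₂ _) (s≤s (s≤s ()))
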